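{- Let $G=(V,E)$ be the complete graph, let $0<\beta\le1$, and let $B$ be a $\beta$-critical block (of some sequence of moves) such that some vertex occurs exactly once in $B$ (i.e. $S_1(B)\ne\emptyset$). Let $\tau_0\in\{\pm1\}^V$ be an initial configuration. Then \[\mathrm{rank}(P_{B,\tau_0})\ \ge\ s_2(B)-r(B)+\sum_{v\in S_2(B)}(b_B(v)-1).\]
   Context: A configuration is $\tau\in\{\pm1\}^V$. A sequence of moves $L$ is a finite sequence of vertices $L(1),\dots,L(\ell(L))$; $\ell(L)$ is its length, $S(L)$ the set of occurring vertices, $s(L)=|S(L)|$. A block of $L$ is a contiguous subsequence of $L$; a block $B$ is $\beta$-critical if $\ell(B)\ge(1+\beta)s(B)$ and $\ell(B')<(1+\beta)s(B')$ for every block $B'$ strictly contained in $B$. For a sequence $B$, $S_1(B)$ is the set of vertices occurring exactly once in $B$ (singletons) and $S_2(B)$ the set of vertices occurring at least twice (repeating); $s_2(B)=|S_2(B)|$. A transition block of $B$ is a maximal block of $B$ all of whose moves are vertices of $S_2(B)$; for $v\in S_2(B)$, $b_B(v)$ is the number of transition blocks of $B$ containing $v$; $R(B)=\{v\in S_2(B): b_B(v)\ge2\}$ and $r(B)=|R(B)|$. Given $\tau_0$, $\tau_t$ is obtained from $\tau_{t-1}$ by flipping the sign of $B(t)$. $M_{B,\tau_0}\in\{0,\pm1\}^{E\times[\ell(B)]}$ has $M_{B,\tau_0}[\{a,b\},t]=+1$ if $B(t)\in\{a,b\}$ and $\tau_t(a)\ne\tau_t(b)$, $-1$ if $B(t)\in\{a,b\}$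 and $\tau_t(a)=\tau_t(b)$, $0$ otherwise. A pair for $v$ is $(t_1,t_2)$ with $t_1<t_2$, $B(t_1)=B(t_2)=v$, $B(t)\ne v$ for $t_1<t<t_2$; $\Gamma(B)$ is the set of all pairs; $P_{B,\tau_0}\in\mathbb{Z}^{E\times\Gamma(B)}$ has $P_{B,\tau_0}[\{a,b\},(t_1,t_2)]=M_{B,\tau_0}[\{a,b\},t_1]+M_{B,\tau_0}[\{a,b\},t_2]$.
   Formalization: The parameter β ranges only over rational numbers with $0<\beta\le1$. -}

module Defs where

open import Data.Nat as ℕ using (ℕ; zero; suc; _∸_; _≟_)
open import Data.Nat.Properties using (_≤?_)
open import Data.Fin as Fin using (Fin; toℕ)
open import Data.Fin.Properties as FinP using ()
open import Data.Bool using (Bool; true; false; if_then_else_; _xor_; not; _∨_)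
open import Data.List using (List; []; _∷_; length; filter; map; take; drop; foldr; zipWith; _∷ʳ_; _++_; allFin)
open import Data.Nat.ListAction using (sum)
open import Data.List.Relation.Unary.All using (All)
open import Data.Maybe using (Maybe; just; nothing)
open import Data.Product using (_×_; _,_; Σ; ∃)
open import Data.Integer using (+_)
open import Data.Rational using (ℚ; 0ℚ; 1ℚ; _/_; _+_; _*_; -_; _≤_; _<_)
open import Relation.Binary.PropositionalEquality using (_≡_; _≢_)
open import Relation.Nullary.Decidable using (⌊_⌋)

-- The complete graph on V = Fin n. Sequences of moves are lists of vertices.
-- Positions in a sequence are 0-based naturals (position i ↔ time t = i+1).

Seq : ℕ → Set
Seq n = List (Fin n)

count : ∀ {n} → Fin n → Seq n → ℕ
count v [] = 0
count v (x ∷ xs) = if ⌊ v Fin.≟ x ⌋ then suc (count v xs) else count v xs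

ℓ : ∀ {n} → Seq n → ℕ
ℓ = length

S : ∀ {n} → Seq n → List (Fin n)
S {n} B = filter (λ v → 1 ≤? count v B) (allFin n)

S₁ : ∀ {n} → Seq n → List (Fin n)
S₁ {n} B = filter (λ v → count v B ≟ 1) (allFin n)

S₂ : ∀ {n} → Seq n → List (Fin n)
S₂ {n} B = filter (λ v → 2 ≤? count v B) (allFin n)

s : ∀ {n} → Seq n → ℕ
s B = length (S B)

s₂ : ∀ {n} → Seq n → ℕ
s₂ B = length (S₂ B)

ℕtoℚ : ℕ → ℚ
ℕtoℚ k = (+ k) / 1

block : ∀ {n} → Seq n → ℕ → ℕ → Seq n
block B i j = take j (drop i B)

Dense : ∀ {n} → ℚ → Seq n → Set
Dense β B = (1ℚ + β) * ℕtoℚ (s B) ≤ ℕtoℚ (ℓ B)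

-- B is β-critical: B is dense and every (nonempty) block strictly contained in B
-- (i.e. a block of length j < ℓ(B)) is not dense.
Critical : ∀ {n} → ℚ → Seq n → Set
Critical β B =
  Dense β B ×
  (∀ i j → 1 ℕ.≤ j → i ℕ.+ j ℕ.≤ ℓ B → j ℕ.< ℓ B →
     ℕtoℚ (ℓ (block B i j)) < (1ℚ + β) * ℕtoℚ (s (block B i j)))

_∈ᵇ_ : ∀ {n} → Fin n → List (Fin n) → Bool
v ∈ᵇ [] = false
v ∈ᵇ (x ∷ xs) = ⌊ v Fin.≟ x ⌋ ∨ (v ∈ᵇ xs)

-- maximal nonempty runs of consecutive elements satisfying p
closeRun : ∀ {n} → Seq n → List (Seq n)
closeRun [] = []
closeRun (x ∷ xs) = (x ∷ xs) ∷ []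

runsAcc : ∀ {n} → (Fin n → Bool) → Seq n → Seq n → List (Seq n)
runsAcc p acc [] = closeRun acc
runsAcc p acc (x ∷ xs) =
  if p x then runsAcc p (acc ∷ʳ x) xs else closeRun acc ++ runsAcc p [] xs

transitionBlocks : ∀ {n} → Seq n → List (Seq n)
transitionBlocks B = runsAcc (λ v → v ∈ᵇ S₂ B) [] B

bB : ∀ {n} → Seq n → Fin n → ℕ
bB B v = length (filter (λ T → v ∈ᵇ T Data.Bool.≟ true) (transitionBlocks B))

R : ∀ {n} → Seq n → List (Fin n)
R B = filter (λ v → 2 ≤? bB B v) (S₂ B)

r : ∀ {n} → Seq n → ℕ
r B = length (R B)

excess : ∀ {n} → Seq n → ℕ
excess B = sum (map (λ v → bB B v ∸ 1) (S₂ B))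

odd : ℕ → Bool
odd zero = false
odd (suc k) = not (odd k)

-- configurations: true ↔ +1, false ↔ −1
Config : ℕ → Set
Config n = Fin n → Bool

config : ∀ {n} → Seq n → Config n → ℕ → Config n
config B τ₀ t x = τ₀ x xor odd (count x (take t B))

nth : ∀ {n} → Seq n → ℕ → Maybe (Fin n)
nth [] _ = nothing
nth (x ∷ xs) zero = just x
nth (x ∷ xs) (suc i) = nth xs i

-- M_{B,τ₀}[{a,b}, t] with t = i+1 (0-based position i); uses τ_t (after the move)
Mentry : ∀ {n} → Seq n → Config n → Fin n → Fin n → ℕ → ℚ
Mentry B τ₀ a b i with nth B i
... | nothing = 0ℚ
... | just w =
  if ⌊ w Fin.≟ a ⌋ ∨ ⌊ w Fin.≟ b ⌋
  then (if config B τ₀ (suc i) a xor config B τ₀ (suc i) b then 1ℚ else - 1ℚ)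
  else 0ℚ

IsPair : ∀ {n} → Seq n → ℕ × ℕ → Set
IsPair B (i , j) =
  i ℕ.< j × j ℕ.< ℓ B ×
  Σ _ λ v → nth B i ≡ just v × nth B j ≡ just v ×
    (∀ k → i ℕ.< k → k ℕ.< j → nth B k ≢ just v)

Pentry : ∀ {n} → Seq n → Config n → Fin n → Fin n → ℕ × ℕ → ℚ
Pentry B τ₀ a b (i , j) = Mentry B τ₀ a b i + Mentry B τ₀ a b j

-- linear independence over ℚ of a family of columns of P_{B,τ₀}
-- (rows indexed by edges {a,b} of the complete graph, a < b)
Independent : ∀ {n : ℕ} → Seq n → Config n → List (ℕ × ℕ) → Set
Independent {n} B τ₀ ps =
  ∀ (cs : List ℚ) → length cs ≡ length ps →
    (∀ (a b : Fin n) → a Fin.< b →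
       foldr _+_ 0ℚ (zipWith (λ c p → c * Pentry B τ₀ a b p) cs ps) ≡ 0ℚ) →
    All (_≡ 0ℚ) cs

-- rank(P_{B,τ₀}) ≥ k over ℚ: some k columns (pairs of B) are linearly independent
RankAtLeast : ∀ {n} → Seq n → Config n → ℕ → Set
RankAtLeast B τ₀ k =
  Σ (List (ℕ × ℕ)) λ ps → length ps ≡ k × All (IsPair B) ps × Independent B τ₀ ps

module Submission where

-- For each repeating vertex v take its crossing pairs (pairs of v inside which a
-- singleton moves) or, if there are none, its initial pair (its first two moves). Two consecutive
-- transition blocks containing v are separated by a move of a vertex outside S₂(B), i.e. of a
-- singleton, so b(v) ≤ 1 + #crossing pairs of v; thus v gives max(1 , b(v) − 1) columns, and these
-- numbers add up to the bound.
--
-- In the row of an edge {v , u}, a column of a pair of v has entry ±2 if u moves once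
-- inside the pair, 0 if u does not move inside it, and columns of pairs of other vertices vanish.
-- So a singleton isolates each crossing column, whose coefficient must vanish. If some initial column
-- had a nonzero coefficient, let a be the first position of a vertex with such a column and take the
-- shortest window B[a , a + m) in which each of these vertices occurring occurs twice. Isolation in
-- the rows {v , x} shows that every vertex of this window occurs twice in it, so ℓ ≥ 2 s for a proper
-- block, which β-criticality with β ≤ 1 forbids.

open import Defs
open import Data.Nat as ℕ using (ℕ; zero; suc; _+_; _∸_; _≤_; _<_; z≤n; s≤s)
import Data.Nat.Properties as ℕP
open import Data.Nat.Properties using (_≤?_)
open import Data.Nat.ListAction using (sum)
import Data.Nat.Coprimality as Coprime
open import Algebra.Properties.CommutativeSemigroup ℕP.+-commutativeSemigroup using (interchange)
import Data.Integer as ℤ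
import Data.Integer.Properties as ℤP
import Data.Sign as Sign
open import Data.Rational as ℚ using (ℚ; 0ℚ; 1ℚ; -_; mkℚ; toℚᵘ)
import Data.Rational.Properties as ℚP
import Data.Rational.Unnormalised as ℚᵘ
import Data.Rational.Unnormalised.Properties as ℚᵘP
open import Data.Fin as F using (Fin)
import Data.Fin.Properties as FinP
open import Data.Bool as Bool using (Bool; true; false; if_then_else_; _xor_; not; _∨_)
import Data.Bool.Properties as BoolP
open import Data.Maybe using (Maybe; just; nothing)
open import Data.Maybe.Properties using (just-injective)
import Data.Maybe.Properties as MaybeP
open import Data.List using (List; []; _∷_; length; take; drop; foldr; zipWith; filter; map; _++_; _∷ʳ_; allFin)
import Data.List.Properties as ListP
open import Data.List.Relation.Unary.All using (All; []; _∷_)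
import Data.List.Relation.Unary.All as All
import Data.List.Relation.Unary.All.Properties as AllP
open import Data.List.Relation.Unary.AllPairs using (AllPairs; []; _∷_)
import Data.List.Relation.Unary.AllPairs as AllPairs
import Data.List.Relation.Unary.AllPairs.Properties as AllPairsP
open import Data.List.Relation.Unary.Any using (here; there)
open import Data.List.Membership.Propositional using (_∈_)
import Data.List.Membership.Propositional.Properties as ∈P
open import Data.Product using (_×_; _,_; Σ; ∃; proj₁; proj₂)
open import Data.Sum using (_⊎_; inj₁; inj₂)
open import Data.Unit using (⊤; tt)
open import Data.Empty using (⊥; ⊥-elim)
open import Function using (_∘_)
open import Relation.Binary using (Tri; tri<; tri≈; tri>)
open import Relation.Binary.PropositionalEquality hiding (J)
open import Relation.Nullary using (¬_; Dec; yes; no)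
open import Relation.Nullary.Decidable using (⌊_⌋; _×-dec_; ¬?; _→-dec_)

hit : ∀ {n} → Fin n → Maybe (Fin n) → ℕ
hit x nothing = 0
hit x (just y) = if ⌊ x F.≟ y ⌋ then 1 else 0

hit-self : ∀ {n} (x : Fin n) → hit x (just x) ≡ 1
hit-self x with x F.≟ x
... | yes _ = refl
... | no x≢x = ⊥-elim (x≢x refl)

hit-other : ∀ {n} (x y : Fin n) → x ≢ y → hit x (just y) ≡ 0
hit-other x y x≢y with x F.≟ y
... | yes x≡y = ⊥-elim (x≢y x≡y)
... | no _ = refl

hit≤1 : ∀ {n} (x : Fin n) m → hit x m ≤ 1
hit≤1 x nothing = z≤n
hit≤1 x (just y) with x F.≟ y
... | yes _ = s≤s z≤n
... | no _ = z≤n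

hit-just : ∀ {n} (x : Fin n) m → 1 ≤ hit x m → m ≡ just x
hit-just x nothing ()
hit-just x (just y) h with x F.≟ y
... | yes x≡y = cong just (sym x≡y)
hit-just x (just y) () | no _

count-cons : ∀ {n} (x y : Fin n) ys → count x (y ∷ ys) ≡ hit x (just y) + count x ys
count-cons x y ys with x F.≟ y
... | yes _ = refl
... | no _ = refl

countIn : ∀ {n} → Seq n → Fin n → ℕ → ℕ → ℕ
countIn B x a zero = 0
countIn B x a (suc k) = hit x (nth B a) + countIn B x (suc a) k

countIn-[] : ∀ {n} (x : Fin n) a k → countIn [] x a k ≡ 0
countIn-[] x a zero = refl
countIn-[] x a (suc k) = countIn-[] x (suc a) k

countIn-shift : ∀ {n} y (B : Seq n) x a k → countIn (y ∷ B) x (suc a) k ≡ countIn B x a k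
countIn-shift y B x a zero = refl
countIn-shift y B x a (suc k) = cong (hit x (nth B a) +_) (countIn-shift y B x (suc a) k)

countIn-block : ∀ {n} (B : Seq n) x a k → count x (block B a k) ≡ countIn B x a k
countIn-block B x a zero = refl
countIn-block [] x zero (suc k) = sym (countIn-[] x 0 (suc k))
countIn-block [] x (suc a) (suc k) = sym (countIn-[] x (suc a) (suc k))
countIn-block (y ∷ B) x zero (suc k) = begin
  count x (y ∷ take k B)              ≡⟨ count-cons x y (take k B) ⟩
  hit x (just y) + count x (take k B) ≡⟨ cong (hit x (just y) +_) (countIn-block B x 0 k) ⟩
  hit x (just y) + countIn B x 0 k    ≡⟨ cong (hit x (just y) +_) (sym (countIn-shift y B x 0 k)) ⟩
  countIn (y ∷ B) x 0 (suc k)         ∎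
  where open ≡-Reasoning
countIn-block (y ∷ B) x (suc a) (suc k) =
  trans (countIn-block B x a (suc k)) (sym (countIn-shift y B x a (suc k)))

count-total : ∀ {n} (B : Seq n) x → count x B ≡ countIn B x 0 (length B)
count-total B x =
  trans (cong (count x) (sym (ListP.take-all (length B) B ℕP.≤-refl))) (countIn-block B x 0 (length B))

countIn-+ : ∀ {n} (B : Seq n) x a k m → countIn B x a (k + m) ≡ countIn B x a k + countIn B x (a + k) m
countIn-+ B x a zero m rewrite ℕP.+-identityʳ a = refl
countIn-+ B x a (suc k) m rewrite countIn-+ B x (suc a) k m | ℕP.+-suc a k =
  sym (ℕP.+-assoc (hit x (nth B a)) _ _)

no-hit : ∀ {n} {x : Fin n} {m} → hit x m ≡ 0 → m ≢ just x
no-hit {x = x} h refl = ℕP.1+n≢0 (trans (sym (hit-self x)) h)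

countIn-pos : ∀ {n} (B : Seq n) x a k p → a ≤ p → p < a + k → nth B p ≡ just x → 1 ≤ countIn B x a k
countIn-pos B x a zero p a≤p p<a+0 _ =
  ⊥-elim (ℕP.<-irrefl refl (ℕP.<-≤-trans p<a+0 (ℕP.≤-trans (ℕP.≤-reflexive (ℕP.+-identityʳ a)) a≤p)))
countIn-pos B x a (suc k) p a≤p p<a+k ep with ℕP.m≤n⇒m<n∨m≡n a≤p
... | inj₁ a<p = ℕP.≤-trans (countIn-pos B x (suc a) k p a<p (ℕP.≤-trans p<a+k (ℕP.≤-reflexive (ℕP.+-suc a k))) ep)
                           (ℕP.m≤n+m _ _)
... | inj₂ refl rewrite ep | hit-self x = s≤s z≤n

countIn-two : ∀ {n} (B : Seq n) x a k p q → a ≤ p → p < q → q < a + k →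
  nth B p ≡ just x → nth B q ≡ just x → 2 ≤ countIn B x a k
countIn-two B x a zero p q a≤p p<q q<a+0 _ _ =
  ⊥-elim (ℕP.<-irrefl refl (ℕP.<-≤-trans q<a+0 (ℕP.≤-trans (ℕP.≤-reflexive (ℕP.+-identityʳ a)) (ℕP.≤-trans a≤p (ℕP.<⇒≤ p<q)))))
countIn-two B x a (suc k) p q a≤p p<q q<a+k ep eq with ℕP.m≤n⇒m<n∨m≡n a≤p
... | inj₁ a<p = ℕP.≤-trans (countIn-two B x (suc a) k p q a<p p<q (ℕP.≤-trans q<a+k (ℕP.≤-reflexive (ℕP.+-suc a k))) ep eq)
                           (ℕP.m≤n+m _ _)
... | inj₂ refl rewrite ep | hit-self x =
  s≤s (countIn-pos B x (suc a) k q p<q (ℕP.≤-trans q<a+k (ℕP.≤-reflexive (ℕP.+-suc a k))) eq)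

firstIn : ∀ {n} (B : Seq n) x a k → 1 ≤ countIn B x a k →
  Σ ℕ λ p → a ≤ p × p < a + k × nth B p ≡ just x × (∀ q → a ≤ q → q < p → nth B q ≢ just x)
firstIn B x a zero ()
firstIn B x a (suc k) h with hit x (nth B a) in eq
... | suc _ = a , ℕP.≤-refl , ℕP.≤-trans (s≤s (ℕP.m≤m+n a k)) (ℕP.≤-reflexive (sym (ℕP.+-suc a k))) ,
              hit-just x (nth B a) (ℕP.≤-trans (s≤s z≤n) (ℕP.≤-reflexive (sym eq))) ,
              λ q a≤q q<a → ⊥-elim (ℕP.<-irrefl refl (ℕP.≤-<-trans a≤q q<a))
... | zero with firstIn B x (suc a) k h
...   | p , a<p , p<end , ep , none =
  p , ℕP.<⇒≤ a<p , ℕP.≤-trans p<end (ℕP.≤-reflexive (sym (ℕP.+-suc a k))) , ep , earlier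
  where
  earlier : ∀ q → a ≤ q → q < p → nth B q ≢ just x
  earlier q a≤q q<p with ℕP.m≤n⇒m<n∨m≡n a≤q
  ... | inj₁ a<q = none q a<q q<p
  ... | inj₂ refl = no-hit eq

occurrenceIn : ∀ {n} (B : Seq n) x a k → 1 ≤ countIn B x a k →
  Σ ℕ λ p → a ≤ p × p < a + k × nth B p ≡ just x
occurrenceIn B x a k h with firstIn B x a k h
... | p , a≤p , p<end , ep , _ = p , a≤p , p<end , ep

countIn-zero : ∀ {n} (B : Seq n) x a k → (∀ p → a ≤ p → p < a + k → nth B p ≢ just x) → countIn B x a k ≡ 0
countIn-zero B x a k none with countIn B x a k in eq
... | zero = refl
... | suc _ with occurrenceIn B x a k (ℕP.≤-trans (s≤s z≤n) (ℕP.≤-reflexive (sym eq)))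
...   | p , a≤p , p<end , ep = ⊥-elim (none p a≤p p<end ep)

firstTwoIn : ∀ {n} (B : Seq n) x a k → 2 ≤ countIn B x a k →
  Σ ℕ λ p → Σ ℕ λ q → a ≤ p × p < q × q < a + k × nth B p ≡ just x × nth B q ≡ just x ×
    (∀ r → a ≤ r → r < p → nth B r ≢ just x) × (∀ r → p < r → r < q → nth B r ≢ just x)
firstTwoIn B x a zero ()
firstTwoIn B x a (suc k) h with hit x (nth B a) in eq
... | suc (suc _) = ⊥-elim (ℕP.<-irrefl refl (ℕP.≤-trans (subst (_≤ 1) eq (hit≤1 x (nth B a))) (s≤s z≤n)))
... | suc zero with firstIn B x (suc a) k (ℕP.≤-pred h)
...   | q , a<q , q<end , eq' , none =
  a , q , ℕP.≤-refl , a<q , ℕP.≤-trans q<end (ℕP.≤-reflexive (sym (ℕP.+-suc a k))) ,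
  hit-just x (nth B a) (ℕP.≤-reflexive (sym eq)) , eq' ,
  (λ r a≤r r<a → ⊥-elim (ℕP.<-irrefl refl (ℕP.≤-<-trans a≤r r<a))) , none
firstTwoIn B x a (suc k) h | zero with firstTwoIn B x (suc a) k h
... | p , q , a<p , p<q , q<end , ep , eq' , before , between =
  p , q , ℕP.<⇒≤ a<p , p<q , ℕP.≤-trans q<end (ℕP.≤-reflexive (sym (ℕP.+-suc a k))) , ep , eq' , earlier , between
  where
  earlier : ∀ r → a ≤ r → r < p → nth B r ≢ just x
  earlier r a≤r r<p with ℕP.m≤n⇒m<n∨m≡n a≤r
  ... | inj₁ a<r = before r a<r r<p
  ... | inj₂ refl = no-hit eq

countIn-mono : ∀ {n} (B : Seq n) x a k a' k' → a ≤ a' → a' + k' ≤ a + k → countIn B x a' k' ≤ countIn B x a k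
countIn-mono B x a k a' k' a≤a' end≤end = begin
  countIn B x a' k'                                ≡⟨ cong (λ b → countIn B x b k') (sym a+d≡a') ⟩
  countIn B x (a + d) k'                           ≤⟨ ℕP.m≤n+m _ _ ⟩
  countIn B x a d + countIn B x (a + d) k'         ≡⟨ sym (countIn-+ B x a d k') ⟩
  countIn B x a (d + k')                           ≤⟨ ℕP.m≤m+n _ _ ⟩
  countIn B x a (d + k') + countIn B x (a + (d + k')) e ≡⟨ sym (countIn-+ B x a (d + k') e) ⟩
  countIn B x a (d + k' + e)                       ≡⟨ cong (countIn B x a) d+k'+e≡k ⟩
  countIn B x a k                                  ∎
  where
  open ℕP.≤-Reasoning
  d = a' ∸ a
  e = (a + k) ∸ (a' + k')
  a+d≡a' : a + d ≡ a'
  a+d≡a' = ℕP.m+[n∸m]≡n a≤a'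
  d+k'+e≡k : d + k' + e ≡ k
  d+k'+e≡k = ℕP.+-cancelˡ-≡ a _ _ (begin-equality
    a + (d + k' + e)   ≡⟨ sym (ℕP.+-assoc a (d + k') e) ⟩
    a + (d + k') + e   ≡⟨ cong (_+ e) (sym (ℕP.+-assoc a d k')) ⟩
    a + d + k' + e     ≡⟨ cong (λ b → b + k' + e) a+d≡a' ⟩
    a' + k' + e        ≡⟨ ℕP.m+[n∸m]≡n end≤end ⟩
    a + k              ∎)

gap : ∀ {n} → Seq n → Fin n → ℕ → ℕ → ℕ
gap B x i j = countIn B x (suc i) (j ∸ suc i)

NoneBetween : ∀ {n} → Seq n → Fin n → ℕ → ℕ → Set
NoneBetween B v i j = ∀ k → i < k → k < j → nth B k ≢ just v

gap-none : ∀ {n} (B : Seq n) v i j → i < j → NoneBetween B v i j → gap B v i j ≡ 0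
gap-none B v i j i<j none =
  countIn-zero B v (suc i) (j ∸ suc i) (λ k i<k k<end → none k i<k (ℕP.<-≤-trans k<end (ℕP.≤-reflexive (ℕP.m+[n∸m]≡n i<j))))

once-between : ∀ {n} (B : Seq n) x a k i j p → a ≤ i → i < p → p < j → j ≤ a + k →
  countIn B x a k ≡ 1 → nth B p ≡ just x → gap B x i j ≡ 1
once-between B x a k i j p a≤i i<p p<j j≤end once ep = ℕP.≤-antisym
  (ℕP.≤-trans (countIn-mono B x a k (suc i) (j ∸ suc i) (ℕP.≤-trans a≤i (ℕP.n≤1+n i)) (ℕP.≤-trans (ℕP.≤-reflexive i+gap≡j) j≤end))
              (ℕP.≤-reflexive once))
  (countIn-pos B x (suc i) (j ∸ suc i) p i<p (ℕP.<-≤-trans p<j (ℕP.≤-reflexive (sym i+gap≡j))) ep)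
  where
  i+gap≡j : suc i + (j ∸ suc i) ≡ j
  i+gap≡j = ℕP.m+[n∸m]≡n (ℕP.<-trans i<p p<j)

two-positions : ∀ {n} (B : Seq n) x p q → p ≢ q → p < length B → q < length B →
  nth B p ≡ just x → nth B q ≡ just x → 2 ≤ count x B
two-positions B x p q p≢q p<ℓ q<ℓ ep eq = subst (2 ≤_) (sym (count-total B x)) (ordered (ℕP.<-cmp p q))
  where
  ordered : Tri (p < q) (p ≡ q) (q < p) → 2 ≤ countIn B x 0 (length B)
  ordered (tri< p<q _ _) = countIn-two B x 0 (length B) p q z≤n p<q q<ℓ ep eq
  ordered (tri≈ _ p≡q _) = ⊥-elim (p≢q p≡q)
  ordered (tri> _ _ q<p) = countIn-two B x 0 (length B) q p z≤n q<p p<ℓ eq ep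

sign : Bool → ℚ
sign b = if b then 1ℚ else - 1ℚ

sign-opposite : ∀ b → sign b ℚ.+ sign (not b) ≡ 0ℚ
sign-opposite true = refl
sign-opposite false = refl

cancel-nonzero : ∀ c d .{{_ : ℚ.NonZero d}} → c ℚ.* d ≡ 0ℚ → c ≡ 0ℚ
cancel-nonzero c d cd≡0 = begin
  c                          ≡⟨ sym (ℚP.*-identityʳ c) ⟩
  c ℚ.* 1ℚ                   ≡⟨ cong (c ℚ.*_) (sym (ℚP.*-inverseʳ d)) ⟩
  c ℚ.* (d ℚ.* ℚ.1/ d)       ≡⟨ sym (ℚP.*-assoc c d (ℚ.1/ d)) ⟩
  c ℚ.* d ℚ.* ℚ.1/ d         ≡⟨ cong (ℚ._* ℚ.1/ d) cd≡0 ⟩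
  0ℚ ℚ.* ℚ.1/ d              ≡⟨ ℚP.*-zeroˡ (ℚ.1/ d) ⟩
  0ℚ                         ∎
  where open ≡-Reasoning

cancel-double-sign : ∀ c b → c ℚ.* (sign b ℚ.+ sign b) ≡ 0ℚ → c ≡ 0ℚ
cancel-double-sign c true = cancel-nonzero c (1ℚ ℚ.+ 1ℚ)
cancel-double-sign c false = cancel-nonzero c (- 1ℚ ℚ.+ - 1ℚ)

disagree : ∀ {n} → Seq n → Config n → Fin n → Fin n → ℕ → Bool
disagree B τ a b t = config B τ t a xor config B τ t b

Mentry-moving : ∀ {n} (B : Seq n) τ a b i → nth B i ≡ just a → Mentry B τ a b i ≡ sign (disagree B τ a b (suc i))
Mentry-moving B τ a b i ei with nth B i
Mentry-moving B τ a b i refl | just .a with a F.≟ a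
... | yes _ = refl
... | no a≢a = ⊥-elim (a≢a refl)

Mentry-away : ∀ {n} (B : Seq n) τ a b i w → nth B i ≡ just w → w ≢ a → w ≢ b → Mentry B τ a b i ≡ 0ℚ
Mentry-away B τ a b i w ei w≢a w≢b with nth B i
Mentry-away B τ a b i w refl w≢a w≢b | just .w with w F.≟ a | w F.≟ b
... | yes w≡a | _ = ⊥-elim (w≢a w≡a)
... | no _ | yes w≡b = ⊥-elim (w≢b w≡b)
... | no _ | no _ = refl

Mentry-sym : ∀ {n} (B : Seq n) τ a b i → Mentry B τ a b i ≡ Mentry B τ b a i
Mentry-sym B τ a b i with nth B i
... | nothing = refl
... | just w with w F.≟ a | w F.≟ b
... | yes _ | yes _ rewrite BoolP.xor-comm (config B τ (suc i) a) (config B τ (suc i) b) = refl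
... | yes _ | no _ rewrite BoolP.xor-comm (config B τ (suc i) a) (config B τ (suc i) b) = refl
... | no _ | yes _ rewrite BoolP.xor-comm (config B τ (suc i) a) (config B τ (suc i) b) = refl
... | no _ | no _ = refl

Pentry-sym : ∀ {n} (B : Seq n) τ a b p → Pentry B τ a b p ≡ Pentry B τ b a p
Pentry-sym B τ a b (i , j) = cong₂ ℚ._+_ (Mentry-sym B τ a b i) (Mentry-sym B τ a b j)

odd-+ : ∀ m k → odd (m + k) ≡ odd m xor odd k
odd-+ zero k = refl
odd-+ (suc m) k rewrite odd-+ m k = BoolP.not-distribˡ-xor (odd m) (odd k)

prefix-split : ∀ {n} (B : Seq n) x i j → i < j →
  count x (take (suc j) B) ≡ count x (take (suc i) B) + gap B x i j + hit x (nth B j)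
prefix-split B x i j i<j = begin
  count x (take (suc j) B)                                  ≡⟨ countIn-block B x 0 (suc j) ⟩
  countIn B x 0 (suc j)                                     ≡⟨ cong (countIn B x 0) (sym total) ⟩
  countIn B x 0 (suc i + g + 1)                             ≡⟨ countIn-+ B x 0 (suc i + g) 1 ⟩
  countIn B x 0 (suc i + g) + countIn B x (suc i + g) 1     ≡⟨ cong₂ _+_ (countIn-+ B x 0 (suc i) g)
                                                                         (cong (λ p → countIn B x p 1) end) ⟩
  countIn B x 0 (suc i) + gap B x i j + (hit x (nth B j) + 0) ≡⟨ cong₂ _+_ (cong (_+ gap B x i j) (sym (countIn-block B x 0 (suc i))))
                                                                          (ℕP.+-identityʳ _) ⟩
  count x (take (suc i) B) + gap B x i j + hit x (nth B j)  ∎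
  where
  open ≡-Reasoning
  g = j ∸ suc i
  end : suc i + g ≡ j
  end = ℕP.m+[n∸m]≡n i<j
  total : suc i + g + 1 ≡ suc j
  total = trans (ℕP.+-comm (suc i + g) 1) (cong suc end)

config-across : ∀ {n} (B : Seq n) τ x i j → i < j →
  config B τ (suc j) x ≡ config B τ (suc i) x xor odd (gap B x i j + hit x (nth B j))
config-across B τ x i j i<j = begin
  τ x xor odd (count x (take (suc j) B))
    ≡⟨ cong (λ m → τ x xor odd m) (trans (prefix-split B x i j i<j) (ℕP.+-assoc (count x (take (suc i) B)) (gap B x i j) (hit x (nth B j)))) ⟩
  τ x xor odd (count x (take (suc i) B) + (gap B x i j + hit x (nth B j)))
    ≡⟨ cong (τ x xor_) (odd-+ (count x (take (suc i) B)) _) ⟩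
  τ x xor (odd (count x (take (suc i) B)) xor odd (gap B x i j + hit x (nth B j)))
    ≡⟨ sym (BoolP.xor-assoc (τ x) _ _) ⟩
  config B τ (suc i) x xor odd (gap B x i j + hit x (nth B j)) ∎
  where open ≡-Reasoning

flip-xor : ∀ a b e → (a xor true) xor (b xor e) ≡ not (a xor b) xor e
flip-xor true true true = refl
flip-xor true true false = refl
flip-xor true false true = refl
flip-xor true false false = refl
flip-xor false true true = refl
flip-xor false true false = refl
flip-xor false false true = refl
flip-xor false false false = refl

-- Across a pair (i , j) of v, the disagreement of v with another vertex u flips once for v's own
-- move and once for every move of u in between.
disagree-across : ∀ {n} (B : Seq n) τ v u i j → i < j → nth B j ≡ just v → NoneBetween B v i j → u ≢ v →
  disagree B τ v u (suc j) ≡ not (disagree B τ v u (suc i)) xor odd (gap B u i j)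
disagree-across B τ v u i j i<j ej none u≢v = begin
  config B τ (suc j) v xor config B τ (suc j) u
    ≡⟨ cong₂ _xor_ (config-across B τ v i j i<j) (config-across B τ u i j i<j) ⟩
  (config B τ (suc i) v xor odd (gap B v i j + hit v (nth B j))) xor
  (config B τ (suc i) u xor odd (gap B u i j + hit u (nth B j)))
    ≡⟨ cong₂ (λ m k → (config B τ (suc i) v xor odd m) xor (config B τ (suc i) u xor odd k)) v-moves u-still ⟩
  (config B τ (suc i) v xor true) xor (config B τ (suc i) u xor odd (gap B u i j))
    ≡⟨ flip-xor (config B τ (suc i) v) (config B τ (suc i) u) (odd (gap B u i j)) ⟩
  not (disagree B τ v u (suc i)) xor odd (gap B u i j) ∎
  where
  open ≡-Reasoning
  v-moves : gap B v i j + hit v (nth B j) ≡ 1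
  v-moves rewrite ej | hit-self v | gap-none B v i j i<j none = refl
  u-still : gap B u i j + hit u (nth B j) ≡ gap B u i j
  u-still rewrite ej | hit-other u v u≢v = ℕP.+-identityʳ _

PairOf : ∀ {n} → Seq n → Fin n → ℕ × ℕ → Set
PairOf B v (i , j) = i < j × nth B i ≡ just v × nth B j ≡ just v × NoneBetween B v i j

Pentry-pair : ∀ {n} (B : Seq n) τ v u i j → PairOf B v (i , j) → u ≢ v →
  Pentry B τ v u (i , j) ≡ sign (disagree B τ v u (suc i)) ℚ.+ sign (not (disagree B τ v u (suc i)) xor odd (gap B u i j))
Pentry-pair B τ v u i j (i<j , ei , ej , none) u≢v =
  cong₂ ℚ._+_ (Mentry-moving B τ v u i ei)
              (trans (Mentry-moving B τ v u j ej) (cong sign (disagree-across B τ v u i j i<j ej none u≢v)))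

Pentry-gap0 : ∀ {n} (B : Seq n) τ v u i j → PairOf B v (i , j) → u ≢ v → gap B u i j ≡ 0 →
  Pentry B τ v u (i , j) ≡ 0ℚ
Pentry-gap0 B τ v u i j pair u≢v g≡0 = begin
  Pentry B τ v u (i , j)                    ≡⟨ Pentry-pair B τ v u i j pair u≢v ⟩
  sign d ℚ.+ sign (not d xor odd (gap B u i j)) ≡⟨ cong (λ g → sign d ℚ.+ sign (not d xor odd g)) g≡0 ⟩
  sign d ℚ.+ sign (not d xor false)         ≡⟨ cong (λ b → sign d ℚ.+ sign b) (BoolP.xor-identityʳ (not d)) ⟩
  sign d ℚ.+ sign (not d)                   ≡⟨ sign-opposite d ⟩
  0ℚ                                        ∎
  where
  open ≡-Reasoning
  d = disagree B τ v u (suc i)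

Pentry-gap1 : ∀ {n} (B : Seq n) τ v u i j → PairOf B v (i , j) → u ≢ v → gap B u i j ≡ 1 →
  Pentry B τ v u (i , j) ≡ sign (disagree B τ v u (suc i)) ℚ.+ sign (disagree B τ v u (suc i))
Pentry-gap1 B τ v u i j pair u≢v g≡1 = begin
  Pentry B τ v u (i , j)                    ≡⟨ Pentry-pair B τ v u i j pair u≢v ⟩
  sign d ℚ.+ sign (not d xor odd (gap B u i j)) ≡⟨ cong (λ g → sign d ℚ.+ sign (not d xor odd g)) g≡1 ⟩
  sign d ℚ.+ sign (not d xor true)          ≡⟨ cong (λ b → sign d ℚ.+ sign b) (not-xor-true d) ⟩
  sign d ℚ.+ sign d                         ∎
  where
  open ≡-Reasoning
  d = disagree B τ v u (suc i)
  not-xor-true : ∀ b → not b xor true ≡ b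
  not-xor-true true = refl
  not-xor-true false = refl

Pentry-away : ∀ {n} (B : Seq n) τ a b w i j → nth B i ≡ just w → nth B j ≡ just w → w ≢ a → w ≢ b →
  Pentry B τ a b (i , j) ≡ 0ℚ
Pentry-away B τ a b w i j ei ej w≢a w≢b
  rewrite Mentry-away B τ a b i w ei w≢a w≢b | Mentry-away B τ a b j w ej w≢a w≢b = refl

at : ∀ {A : Set} → List A → ℕ → A → A
at [] k d = d
at (x ∷ xs) zero d = x
at (x ∷ xs) (suc k) d = at xs k d

combination : ∀ {P : Set} → (P → ℚ) → List ℚ → List P → ℚ
combination f cs ps = foldr ℚ._+_ 0ℚ (zipWith (λ c p → c ℚ.* f p) cs ps)

combination-cong : ∀ {P : Set} (f g : P → ℚ) cs ps → (∀ p → f p ≡ g p) → combination f cs ps ≡ combination g cs ps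
combination-cong f g [] ps f≗g = refl
combination-cong f g (c ∷ cs) [] f≗g = refl
combination-cong f g (c ∷ cs) (p ∷ ps) f≗g = cong₂ ℚ._+_ (cong (c ℚ.*_) (f≗g p)) (combination-cong f g cs ps f≗g)

module _ {P : Set} (f : P → ℚ) (d : P) where

  combination-zero : ∀ cs ps → (∀ k → k < length ps → at cs k 0ℚ ℚ.* f (at ps k d) ≡ 0ℚ) → combination f cs ps ≡ 0ℚ
  combination-zero [] ps all0 = refl
  combination-zero (c ∷ cs) [] all0 = refl
  combination-zero (c ∷ cs) (p ∷ ps) all0 =
    trans (cong₂ ℚ._+_ (all0 0 (s≤s z≤n)) (combination-zero cs ps (λ k k< → all0 (suc k) (s≤s k<))))
          (ℚP.+-identityʳ 0ℚ)

  combination-single : ∀ cs ps i → i < length ps →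
    (∀ k → k < length ps → k ≢ i → at cs k 0ℚ ℚ.* f (at ps k d) ≡ 0ℚ) →
    combination f cs ps ≡ at cs i 0ℚ ℚ.* f (at ps i d)
  combination-single [] ps i i< others = sym (ℚP.*-zeroˡ (f (at ps i d)))
  combination-single (c ∷ cs) (p ∷ ps) zero i< others =
    trans (cong (c ℚ.* f p ℚ.+_) (combination-zero cs ps (λ k k< → others (suc k) (s≤s k<) (λ ()))))
          (ℚP.+-identityʳ _)
  combination-single (c ∷ cs) (p ∷ ps) (suc i) (s≤s i<) others =
    trans (cong₂ ℚ._+_ (others 0 (s≤s z≤n) (λ ())) (combination-single cs ps i i< (λ k k< k≢i → others (suc k) (s≤s k<) (k≢i ∘ ℕP.suc-injective))))
          (ℚP.+-identityˡ _)

all-at : ∀ {A : Set} {P : A → Set} (xs : List A) d → (∀ k → k < length xs → P (at xs k d)) → All P xs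
all-at [] d h = []
all-at (x ∷ xs) d h = h 0 (s≤s z≤n) ∷ all-at xs d (λ k k< → h (suc k) (s≤s k<))

All-at : ∀ {A : Set} {P : A → Set} {xs : List A} d → All P xs → ∀ k → k < length xs → P (at xs k d)
All-at d (px ∷ pxs) zero k< = px
All-at d (px ∷ pxs) (suc k) (s≤s k<) = All-at d pxs k k<

at-∈ : ∀ {A : Set} (xs : List A) d k → k < length xs → at xs k d ∈ xs
at-∈ (x ∷ xs) d zero k< = here refl
at-∈ (x ∷ xs) d (suc k) (s≤s k<) = there (at-∈ xs d k k<)

at-injective : ∀ {A : Set} {xs : List A} d → AllPairs _≢_ xs → ∀ k l → k < length xs → l < length xs →
  at xs k d ≡ at xs l d → k ≡ l
at-injective d (x∉ ∷ distinct) zero zero k< l< eq = refl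
at-injective {xs = x ∷ xs} d (x∉ ∷ distinct) zero (suc l) k< (s≤s l<) eq = ⊥-elim (All.lookup x∉ (at-∈ xs d l l<) eq)
at-injective {xs = x ∷ xs} d (x∉ ∷ distinct) (suc k) zero (s≤s k<) l< eq = ⊥-elim (All.lookup x∉ (at-∈ xs d k k<) (sym eq))
at-injective d (x∉ ∷ distinct) (suc k) (suc l) (s≤s k<) (s≤s l<) eq = cong suc (at-injective d distinct k l k< l< eq)

module _ (P : ℕ → Set) (P? : ∀ k → Dec (P k)) where

  Least : Set
  Least = Σ ℕ λ a → P a × (∀ q → q < a → ¬ P q)

  private
    search-from : ∀ b → (∀ q → q < b → ¬ P q) → ∀ d → P (b + d) → Least
    search-from b below d p with P? b
    ... | yes pb = b , pb , below
    search-from b below zero p | no ¬pb = ⊥-elim (¬pb (subst P (ℕP.+-identityʳ b) p))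
    search-from b below (suc d) p | no ¬pb = search-from (suc b) below′ d (subst P (ℕP.+-suc b d) p)
      where
      below′ : ∀ q → q < suc b → ¬ P q
      below′ q q<1+b with ℕP.m≤n⇒m<n∨m≡n (ℕP.≤-pred q<1+b)
      ... | inj₁ q<b = below q q<b
      ... | inj₂ refl = ¬pb

  least : ∀ m → P m → Least
  least m pm = search-from 0 (λ _ ()) m pm

sum-map-+ : ∀ {A : Set} (f g : A → ℕ) xs → sum (map (λ v → f v + g v) xs) ≡ sum (map f xs) + sum (map g xs)
sum-map-+ f g [] = refl
sum-map-+ f g (x ∷ xs) rewrite sum-map-+ f g xs = interchange (f x) (g x) (sum (map f xs)) (sum (map g xs))

sum-map-0 : ∀ {A : Set} (xs : List A) → sum (map (λ _ → 0) xs) ≡ 0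
sum-map-0 [] = refl
sum-map-0 (x ∷ xs) = sum-map-0 xs

sum-allFin-suc : ∀ n (f : Fin (suc n) → ℕ) → sum (map f (allFin (suc n))) ≡ f F.zero + sum (map (f ∘ F.suc) (allFin n))
sum-allFin-suc n f = cong (λ xs → f F.zero + sum xs)
  (trans (ListP.map-tabulate F.suc f) (sym (ListP.map-tabulate (λ i → i) (f ∘ F.suc))))

sum-hit : ∀ n (x : Fin n) → sum (map (λ v → hit v (just x)) (allFin n)) ≡ 1
sum-hit (suc n) F.zero = begin
  sum (map (λ v → hit v (just F.zero)) (allFin (suc n)))           ≡⟨ sum-allFin-suc n (λ v → hit v (just F.zero)) ⟩
  hit {suc n} F.zero (just F.zero) + sum (map (λ v → hit (F.suc v) (just F.zero)) (allFin n))
    ≡⟨ cong₂ _+_ (hit-self {suc n} F.zero) (cong sum (ListP.map-cong (λ v → hit-other (F.suc v) F.zero (λ ())) (allFin n))) ⟩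
  1 + sum (map (λ _ → 0) (allFin n))                               ≡⟨ cong suc (sum-map-0 (allFin n)) ⟩
  1                                                                ∎
  where open ≡-Reasoning
sum-hit (suc n) (F.suc x) = begin
  sum (map (λ v → hit v (just (F.suc x))) (allFin (suc n)))       ≡⟨ sum-allFin-suc n (λ v → hit v (just (F.suc x))) ⟩
  hit F.zero (just (F.suc x)) + sum (map (λ v → hit (F.suc v) (just (F.suc x))) (allFin n))
    ≡⟨ cong₂ _+_ (hit-other F.zero (F.suc x) (λ ())) (cong sum (ListP.map-cong hit-suc (allFin n))) ⟩
  sum (map (λ v → hit v (just x)) (allFin n))                      ≡⟨ sum-hit n x ⟩
  1                                                                ∎
  where
  open ≡-Reasoning
  hit-suc : ∀ v → hit (F.suc v) (just (F.suc x)) ≡ hit v (just x)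
  hit-suc v = by-cases (v F.≟ x)
    where
    by-cases : Dec (v ≡ x) → hit (F.suc v) (just (F.suc x)) ≡ hit v (just x)
    by-cases (yes refl) = trans (hit-self (F.suc v)) (sym (hit-self v))
    by-cases (no v≢x) = trans (hit-other (F.suc v) (F.suc x) (v≢x ∘ FinP.suc-injective)) (sym (hit-other v x v≢x))

length-counts : ∀ {n} (X : Seq n) → length X ≡ sum (map (λ v → count v X) (allFin n))
length-counts {n} [] = sym (sum-map-0 (allFin n))
length-counts {n} (x ∷ X) = sym (begin
  sum (map (λ v → count v (x ∷ X)) (allFin n))
    ≡⟨ cong sum (ListP.map-cong (λ v → count-cons v x X) (allFin n)) ⟩
  sum (map (λ v → hit v (just x) + count v X) (allFin n))
    ≡⟨ sum-map-+ (λ v → hit v (just x)) (λ v → count v X) (allFin n) ⟩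
  sum (map (λ v → hit v (just x)) (allFin n)) + sum (map (λ v → count v X) (allFin n))
    ≡⟨ cong₂ _+_ (sum-hit n x) (sym (length-counts X)) ⟩
  suc (length X) ∎)
  where open ≡-Reasoning

double-support : ∀ {A : Set} (f : A → ℕ) xs → (∀ v → 1 ≤ f v → 2 ≤ f v) →
  length (filter (λ v → 1 ≤? f v) xs) + length (filter (λ v → 1 ≤? f v) xs) ≤ sum (map f xs)
double-support f [] twice = z≤n
double-support f (x ∷ xs) twice with 1 ≤? f x
... | no fx≱1 rewrite ListP.filter-reject (λ v → 1 ≤? f v) {x} {xs} fx≱1 =
  ℕP.≤-trans (double-support f xs twice) (ℕP.m≤n+m _ _)
... | yes fx≥1 rewrite ListP.filter-accept (λ v → 1 ≤? f v) {x} {xs} fx≥1 = begin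
  suc (k + suc k)          ≡⟨ cong suc (ℕP.+-suc k k) ⟩
  2 + (k + k)              ≡⟨ ℕP.+-comm 2 (k + k) ⟩
  k + k + 2                ≤⟨ ℕP.+-mono-≤ (double-support f xs twice) (twice x fx≥1) ⟩
  sum (map f xs) + f x     ≡⟨ ℕP.+-comm (sum (map f xs)) (f x) ⟩
  f x + sum (map f xs)     ∎
  where
  open ℕP.≤-Reasoning
  k = length (filter (λ v → 1 ≤? f v) xs)

no-singletons-long : ∀ {n} (X : Seq n) → (∀ v → 1 ≤ count v X → 2 ≤ count v X) → s X + s X ≤ ℓ X
no-singletons-long {n} X twice =
  ℕP.≤-trans (double-support (λ v → count v X) (allFin n) twice) (ℕP.≤-reflexive (sym (length-counts X)))

ℕtoℚ-mkℚ : ∀ k → ℕtoℚ k ≡ mkℚ (ℤ.+ k) 0 (Coprime.sym (Coprime.1-coprimeTo k))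
ℕtoℚ-mkℚ k = ℚP.normalize-coprime (Coprime.sym (Coprime.1-coprimeTo k))

sparse⇒short : ∀ β → β ℚ.≤ 1ℚ → ∀ L S → ℕtoℚ L ℚ.< (1ℚ ℚ.+ β) ℚ.* ℕtoℚ S → L < S + S
sparse⇒short β β≤1 L S sparse = from-ℚᵘ (subst (λ t → ℚᵘ.mkℚᵘ (ℤ.+ L) 0 ℚᵘ.< ℚᵘ.mkℚᵘ t 0) 2·S≡S+S twice-as-ℚᵘ)
  where
  below-2S : ℕtoℚ L ℚ.< (1ℚ ℚ.+ 1ℚ) ℚ.* ℕtoℚ S
  below-2S = ℚP.<-≤-trans sparse (subst (λ q → (1ℚ ℚ.+ β) ℚ.* q ℚ.≤ (1ℚ ℚ.+ 1ℚ) ℚ.* q) (sym (ℕtoℚ-mkℚ S))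
    (ℚP.*-monoʳ-≤-nonNeg (mkℚ (ℤ.+ S) 0 (Coprime.sym (Coprime.1-coprimeTo S))) (ℚP.+-monoʳ-≤ 1ℚ β≤1)))
  twice-as-ℚᵘ : ℚᵘ.mkℚᵘ (ℤ.+ L) 0 ℚᵘ.< ℚᵘ.mkℚᵘ (ℤ.+ 2) 0 ℚᵘ.* ℚᵘ.mkℚᵘ (ℤ.+ S) 0
  twice-as-ℚᵘ = subst₂ (λ x y → toℚᵘ x ℚᵘ.< toℚᵘ (1ℚ ℚ.+ 1ℚ) ℚᵘ.* toℚᵘ y) (ℕtoℚ-mkℚ L) (ℕtoℚ-mkℚ S)
    (ℚᵘP.<-respʳ-≃ (ℚP.toℚᵘ-homo-* (1ℚ ℚ.+ 1ℚ) (ℕtoℚ S)) (ℚP.toℚᵘ-mono-< below-2S))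
  2·S≡S+S : Sign.+ ℤ.◃ (S + (S + 0)) ≡ ℤ.+ (S + S)
  2·S≡S+S = trans (ℤP.+◃n≡+n (S + (S + 0))) (cong (λ x → ℤ.+ (S + x)) (ℕP.+-identityʳ S))
  from-ℚᵘ : ℚᵘ.mkℚᵘ (ℤ.+ L) 0 ℚᵘ.< ℚᵘ.mkℚᵘ (ℤ.+ (S + S)) 0 → L < S + S
  from-ℚᵘ (ℚᵘ.*<* L·1<2S·1) = subst₂ _<_ (ℕP.*-identityʳ L) (ℕP.*-identityʳ (S + S))
    (ℤP.drop‿+<+ (subst₂ ℤ._<_ (ℤP.+◃n≡+n (L ℕ.* 1)) (ℤP.+◃n≡+n ((S + S) ℕ.* 1)) L·1<2S·1))

Short : ∀ {n} → Seq n → Set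
Short B = ∀ i j → 1 ≤ j → i + j ≤ ℓ B → j < ℓ B → ℓ (block B i j) < s (block B i j) + s (block B i j)

critical⇒short : ∀ {n} β → β ℚ.≤ 1ℚ → (B : Seq n) → Critical β B → Short B
critical⇒short β β≤1 B (_ , sparse) i j 1≤j fits proper =
  sparse⇒short β β≤1 (ℓ (block B i j)) (s (block B i j)) (sparse i j 1≤j fits proper)

pairs-of-same-vertex : ∀ {n} (B : Seq n) v i j i' j' → PairOf B v (i , j) → PairOf B v (i' , j') →
  (i ≡ i' × j ≡ j') ⊎ (j ≤ i' ⊎ j' ≤ i)
pairs-of-same-vertex B v i j i' j' (i<j , ei , ej , none) (i'<j' , ei' , ej' , none') with ℕP.<-cmp i i'
... | tri< i<i' _ _ with ℕP.<-cmp i' j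
...   | tri< i'<j _ _ = ⊥-elim (none i' i<i' i'<j ei')
...   | tri≈ _ i'≡j _ = inj₂ (inj₁ (ℕP.≤-reflexive (sym i'≡j)))
...   | tri> _ _ j<i' = inj₂ (inj₁ (ℕP.<⇒≤ j<i'))
pairs-of-same-vertex B v i j i' j' (i<j , ei , ej , none) (i'<j' , ei' , ej' , none') | tri> _ _ i'<i with ℕP.<-cmp i j'
...   | tri< i<j' _ _ = ⊥-elim (none' i i'<i i<j' ei)
...   | tri≈ _ i≡j' _ = inj₂ (inj₂ (ℕP.≤-reflexive (sym i≡j')))
...   | tri> _ _ j'<i = inj₂ (inj₂ (ℕP.<⇒≤ j'<i))
pairs-of-same-vertex B v i j i' j' (i<j , ei , ej , none) (i'<j' , ei' , ej' , none') | tri≈ _ refl _ with ℕP.<-cmp j j'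
...   | tri< j<j' _ _ = ⊥-elim (none' j i<j j<j' ej)
...   | tri≈ _ j≡j' _ = inj₁ (refl , j≡j')
...   | tri> _ _ j'<j = ⊥-elim (none j' i'<j' j'<j ej')

singleton-once : ∀ {n} (B : Seq n) w → count w B ≡ 1 → ¬ (2 ≤ count w B)
singleton-once B w single twice with subst (2 ≤_) single twice
... | s≤s ()

pair-repeats : ∀ {n} (B : Seq n) v i j → PairOf B v (i , j) → j < ℓ B → 2 ≤ count v B
pair-repeats B v i j (i<j , ei , ej , _) j<ℓ = two-positions B v i j (ℕP.<⇒≢ i<j) (ℕP.<-trans i<j j<ℓ) j<ℓ ei ej

singleton-in-one-pair : ∀ {n} (B : Seq n) v w i j i' j' m → count w B ≡ 1 →
  PairOf B v (i , j) → PairOf B v (i' , j') → j < ℓ B → j' < ℓ B →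
  i < m → m < j → nth B m ≡ just w → 1 ≤ gap B w i' j' → (i , j) ≡ (i' , j')
singleton-in-one-pair B v w i j i' j' m single pair pair'@(i'<j' , _) j<ℓ j'<ℓ i<m m<j em inside
  with occurrenceIn B w (suc i') (j' ∸ suc i') inside
... | m' , i'<m' , m'<end , em' =
  resolve (pairs-of-same-vertex B v i j i' j' pair pair')
  where
  m'<j' : m' < j'
  m'<j' = ℕP.<-≤-trans m'<end (ℕP.≤-reflexive (ℕP.m+[n∸m]≡n i'<j'))
  m≡m' : m ≡ m'
  m≡m' with m ℕ.≟ m'
  ... | yes m≡m' = m≡m'
  ... | no m≢m' = ⊥-elim (singleton-once B w single
                    (two-positions B w m m' m≢m' (ℕP.<-trans m<j j<ℓ) (ℕP.<-trans m'<j' j'<ℓ) em em'))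
  resolve : (i ≡ i' × j ≡ j') ⊎ (j ≤ i' ⊎ j' ≤ i) → (i , j) ≡ (i' , j')
  resolve (inj₁ (refl , refl)) = refl
  resolve (inj₂ (inj₁ j≤i')) = ⊥-elim (ℕP.<-irrefl m≡m' (ℕP.<-trans m<j (ℕP.≤-<-trans j≤i' i'<m')))
  resolve (inj₂ (inj₂ j'≤i)) = ⊥-elim (ℕP.<-irrefl (sym m≡m') (ℕP.<-trans m'<j' (ℕP.≤-<-trans j'≤i i<m)))

Initial : ∀ {n} → Seq n → ℕ × ℕ → Set
Initial {n} B (i , j) = ∀ (v : Fin n) → nth B i ≡ just v → ∀ m → m < i → nth B m ≢ just v

initial-pair-unique : ∀ {n} (B : Seq n) v i j i' j' → PairOf B v (i , j) → PairOf B v (i' , j') →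
  Initial B (i , j) → Initial B (i' , j') → (i , j) ≡ (i' , j')
initial-pair-unique B v i j i' j' pair@(i<j , ei , _) pair'@(i'<j' , ei' , _) initial initial' =
  resolve (pairs-of-same-vertex B v i j i' j' pair pair')
  where
  i≡i' : i ≡ i'
  i≡i' with ℕP.<-cmp i i'
  ... | tri< i<i' _ _ = ⊥-elim (initial' v ei' i i<i' ei)
  ... | tri≈ _ i≡i' _ = i≡i'
  ... | tri> _ _ i'<i = ⊥-elim (initial v ei i' i'<i ei')
  resolve : (i ≡ i' × j ≡ j') ⊎ (j ≤ i' ⊎ j' ≤ i) → (i , j) ≡ (i' , j')
  resolve (inj₁ (refl , refl)) = refl
  resolve (inj₂ (inj₁ j≤i')) = ⊥-elim (ℕP.<-irrefl i≡i' (ℕP.<-≤-trans i<j j≤i'))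
  resolve (inj₂ (inj₂ j'≤i)) = ⊥-elim (ℕP.<-irrefl (sym i≡i') (ℕP.<-≤-trans i'<j' j'≤i))

initial-first : ∀ {n} (B : Seq n) v i j q → nth B i ≡ just v → Initial B (i , j) → nth B q ≡ just v → i ≤ q
initial-first B v i j q ei initial eq = ℕP.≮⇒≥ (λ q<i → initial v ei q q<i eq)

Crossing : ∀ {n} → Seq n → ℕ × ℕ → Set
Crossing {n} B (i , j) = Σ ℕ λ m → i < m × m < j × Σ (Fin n) λ w → nth B m ≡ just w × count w B ≡ 1

Admissible : ∀ {n} → Seq n → List (ℕ × ℕ) → Set
Admissible B ps = All (λ q → IsPair B q × (Crossing B q ⊎ Initial B q)) ps × AllPairs _≢_ ps

pair-next : ∀ {n} (B : Seq n) v i j q → PairOf B v (i , j) → i < q → nth B q ≡ just v → j ≤ q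
pair-next B v i j q (_ , _ , _ , none) i<q eq = ℕP.≮⇒≥ (λ q<j → none q i<q q<j eq)

pair-vertex : ∀ {n} (B : Seq n) q → IsPair B q → Fin n
pair-vertex B q (_ , _ , v , _) = v

pair-of-vertex : ∀ {n} (B : Seq n) q (p : IsPair B q) → PairOf B (pair-vertex B q p) q
pair-of-vertex B q (i<j , _ , _ , ei , ej , none) = i<j , ei , ej , none

module Independence {n} (B : Seq n) (τ : Config n) (ps : List (ℕ × ℕ)) (admissible : Admissible B ps)
  (w₀ : Fin n) (w₀-single : count w₀ B ≡ 1) (short : Short B)
  (cs : List ℚ) (relation : ∀ (a b : Fin n) → a F.< b → combination (Pentry B τ a b) cs ps ≡ 0ℚ) where

  L : ℕ
  L = length ps

  c : ℕ → ℚ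
  c k = at cs k 0ℚ

  column : ℕ → ℕ × ℕ
  column k = at ps k (0 , 0)

  I J : ℕ → ℕ
  I k = proj₁ (column k)
  J k = proj₂ (column k)

  column-admissible : ∀ k → k < L → IsPair B (column k) × (Crossing B (column k) ⊎ Initial B (column k))
  column-admissible = All-at (0 , 0) (proj₁ admissible)

  column-injective : ∀ k l → k < L → l < L → column k ≡ column l → k ≡ l
  column-injective = at-injective (0 , 0) (proj₂ admissible)

  vertex : ∀ k → k < L → Fin n
  vertex k k<L = pair-vertex B (column k) (proj₁ (column-admissible k k<L))

  pair : ∀ k (k<L : k < L) → PairOf B (vertex k k<L) (column k)
  pair k k<L = pair-of-vertex B (column k) (proj₁ (column-admissible k k<L))

  end<ℓ : ∀ k → k < L → J k < ℓ B
  end<ℓ k k<L = proj₁ (proj₂ (proj₁ (column-admissible k k<L)))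

  vertex-at : ∀ k (k<L : k < L) → nth B (I k) ≡ just (vertex k k<L)
  vertex-at k k<L = proj₁ (proj₂ (pair k k<L))

  pair-of : ∀ {x} k (k<L : k < L) → vertex k k<L ≡ x → PairOf B x (column k)
  pair-of k k<L refl = pair k k<L

  relation-sym : ∀ a b → a ≢ b → combination (Pentry B τ a b) cs ps ≡ 0ℚ
  relation-sym a b a≢b with FinP.<-cmp a b
  ... | tri< a<b _ _ = relation a b a<b
  ... | tri≈ _ a≡b _ = ⊥-elim (a≢b a≡b)
  ... | tri> _ _ b<a = trans (combination-cong (Pentry B τ a b) (Pentry B τ b a) cs ps (Pentry-sym B τ a b)) (relation b a b<a)

  term : Fin n → Fin n → ℕ → ℚ
  term a b l = c l ℚ.* Pentry B τ a b (column l)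

  isolated-zero : ∀ k (k<L : k < L) u → u ≢ vertex k k<L → gap B u (I k) (J k) ≡ 1 →
    (∀ l (l<L : l < L) → l ≢ k → vertex l l<L ≡ vertex k k<L → term (vertex k k<L) u l ≡ 0ℚ) →
    (∀ l (l<L : l < L) → vertex l l<L ≡ u → c l ≡ 0ℚ) → c k ≡ 0ℚ
  isolated-zero k k<L u u≢v gap≡1 same-vertex at-u = cancel-double-sign (c k) d (begin
    c k ℚ.* (sign d ℚ.+ sign d)  ≡⟨ cong (c k ℚ.*_) (sym (Pentry-gap1 B τ v u (I k) (J k) (pair k k<L) u≢v gap≡1)) ⟩
    term v u k                   ≡⟨ sym (combination-single (Pentry B τ v u) (0 , 0) cs ps k k<L others) ⟩
    combination (Pentry B τ v u) cs ps ≡⟨ relation-sym v u (λ v≡u → u≢v (sym v≡u)) ⟩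
    0ℚ                           ∎)
    where
    open ≡-Reasoning
    v = vertex k k<L
    d = disagree B τ v u (suc (I k))
    others : ∀ l → l < L → l ≢ k → term v u l ≡ 0ℚ
    others l l<L l≢k with vertex l l<L F.≟ v | vertex l l<L F.≟ u
    ... | yes x≡v | _ = same-vertex l l<L l≢k x≡v
    ... | no _ | yes x≡u = trans (cong (ℚ._* Pentry B τ v u (column l)) (at-u l l<L x≡u)) (ℚP.*-zeroˡ (Pentry B τ v u (column l)))
    ... | no x≢v | no x≢u with pair l l<L
    ...   | _ , ei , ej , _ = trans (cong (c l ℚ.*_) (Pentry-away B τ v u (vertex l l<L) (I l) (J l) ei ej x≢v x≢u))
                                    (ℚP.*-zeroʳ (c l))

  -- Columns crossing a singleton have zero coefficient: the singleton isolates them.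
  crossing-zero : ∀ k (k<L : k < L) → Crossing B (column k) → c k ≡ 0ℚ
  crossing-zero k k<L (m , I<m , m<J , w , em , single) = isolated-zero k k<L w w≢v gap≡1 same-vertex at-w
    where
    v = vertex k k<L
    w≢v : w ≢ v
    w≢v refl = singleton-once B w single (pair-repeats B w (I k) (J k) (pair k k<L) (end<ℓ k k<L))
    gap≡1 : gap B w (I k) (J k) ≡ 1
    gap≡1 = once-between B w 0 (ℓ B) (I k) (J k) m z≤n I<m m<J (ℕP.<⇒≤ (end<ℓ k k<L))
              (trans (sym (count-total B w)) single) em
    same-vertex : ∀ l (l<L : l < L) → l ≢ k → vertex l l<L ≡ v → term v w l ≡ 0ℚ
    same-vertex l l<L l≢k x≡v = trans (cong (c l ℚ.*_) (Pentry-gap0 B τ v w (I l) (J l) pair-l w≢v gap≡0)) (ℚP.*-zeroʳ (c l))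
      where
      pair-l : PairOf B v (column l)
      pair-l = pair-of l l<L x≡v
      gap≡0 : gap B w (I l) (J l) ≡ 0
      gap≡0 with gap B w (I l) (J l) in eq
      ... | zero = refl
      ... | suc _ = ⊥-elim (l≢k (column-injective l k l<L k<L (sym
              (singleton-in-one-pair B v w (I k) (J k) (I l) (J l) m single (pair k k<L) pair-l (end<ℓ k k<L) (end<ℓ l l<L)
                 I<m m<J em (ℕP.≤-trans (s≤s z≤n) (ℕP.≤-reflexive (sym eq)))))))
    at-w : ∀ l (l<L : l < L) → vertex l l<L ≡ w → c l ≡ 0ℚ
    at-w l l<L x≡w = ⊥-elim (singleton-once B w single (pair-repeats B w (I l) (J l) (pair-of l l<L x≡w) (end<ℓ l l<L)))

  supported-initial : ∀ k (k<L : k < L) → c k ≢ 0ℚ → Initial B (column k)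
  supported-initial k k<L ck≢0 with proj₂ (column-admissible k k<L)
  ... | inj₁ crossing = ⊥-elim (ck≢0 (crossing-zero k k<L crossing))
  ... | inj₂ initial = initial

  -- Two supported columns of the same vertex are both its initial pair, hence the same column.
  supported-unique : ∀ k l (k<L : k < L) (l<L : l < L) → c k ≢ 0ℚ → c l ≢ 0ℚ → vertex k k<L ≡ vertex l l<L → k ≡ l
  supported-unique k l k<L l<L ck≢0 cl≢0 same = column-injective k l k<L l<L
    (initial-pair-unique B (vertex l l<L) (I k) (J k) (I l) (J l) (pair-of k k<L same) (pair l l<L)
       (supported-initial k k<L ck≢0) (supported-initial l l<L cl≢0))

  Support : Fin n → Set
  Support x = ∃ λ l → l < L × (c l ≢ 0ℚ × nth B (I l) ≡ just x)

  support? : ∀ x → Dec (Support x)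
  support? x = ℕP.anyUpTo? (λ l → ¬? (c l ℚP.≟ 0ℚ) ×-dec MaybeP.≡-dec F._≟_ (nth B (I l)) (just x)) L

  support-vertex : ∀ {x} ((l , l<L , _ , el) : Support x) → vertex l l<L ≡ x
  support-vertex (l , l<L , _ , el) = just-injective (trans (sym (vertex-at l l<L)) el)

  -- Closure: a vertex moving exactly once inside a supported column is supported,
  -- since otherwise the row {v , x} isolates that column.
  support-closed : ∀ k (k<L : k < L) → c k ≢ 0ℚ → ∀ x → gap B x (I k) (J k) ≡ 1 → Support x
  support-closed k k<L ck≢0 x gap≡1 with support? x
  ... | yes supported = supported
  ... | no unsupported = ⊥-elim (ck≢0 (isolated-zero k k<L x x≢v gap≡1 same-vertex at-x))
    where
    x≢v : x ≢ vertex k k<L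
    x≢v refl with pair k k<L
    ... | I<J , _ , _ , none = ℕP.1+n≢0 (trans (sym gap≡1) (gap-none B x (I k) (J k) I<J none))
    same-vertex : ∀ l (l<L : l < L) → l ≢ k → vertex l l<L ≡ vertex k k<L → term (vertex k k<L) x l ≡ 0ℚ
    same-vertex l l<L l≢k same with c l ℚP.≟ 0ℚ
    ... | yes cl≡0 = trans (cong (ℚ._* Pentry B τ (vertex k k<L) x (column l)) cl≡0) (ℚP.*-zeroˡ (Pentry B τ (vertex k k<L) x (column l)))
    ... | no cl≢0 = ⊥-elim (l≢k (supported-unique l k l<L k<L cl≢0 ck≢0 same))
    at-x : ∀ l (l<L : l < L) → vertex l l<L ≡ x → c l ≡ 0ℚ
    at-x l l<L x≡x' with c l ℚP.≟ 0ℚ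
    ... | yes cl≡0 = cl≡0
    ... | no cl≢0 = ⊥-elim (unsupported (l , l<L , cl≢0 , trans (vertex-at l l<L) (cong just x≡x')))

  SupportedAt : ℕ → Set
  SupportedAt p = Σ (Fin n) λ x → nth B p ≡ just x × Support x

  supportedAt? : ∀ p → Dec (SupportedAt p)
  supportedAt? p with nth B p
  ... | nothing = no λ { (_ , () , _) }
  ... | just y with support? y
  ...   | yes supported = yes (y , refl , supported)
  ...   | no unsupported = no λ { (_ , refl , supported) → unsupported supported }

  module FromFirstSupported (a : ℕ) (a-supported : SupportedAt a) (a-first : ∀ q → q < a → ¬ SupportedAt q) where

    starts-after : ∀ k (k<L : k < L) → c k ≢ 0ℚ → a ≤ I k
    starts-after k k<L ck≢0 = ℕP.≮⇒≥ (λ I<a → a-first (I k) I<a (vertex k k<L , vertex-at k k<L , (k , k<L , ck≢0 , vertex-at k k<L)))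

    a<ℓ : a < ℓ B
    a<ℓ = below-end a-supported
      where
      below-end : SupportedAt a → a < ℓ B
      below-end (_ , _ , (k , k<L , ck≢0 , _)) =
        ℕP.≤-<-trans (starts-after k k<L ck≢0) (ℕP.<-trans (proj₁ (pair k k<L)) (end<ℓ k k<L))

    supported-at-a : ∀ x → nth B a ≡ just x → Support x
    supported-at-a x ex = at-a a-supported
      where
      at-a : SupportedAt a → Support x
      at-a (x' , ex' , supported) = subst Support (just-injective (trans (sym ex') ex)) supported

    Closed : ℕ → Set
    Closed m = ∀ x → Support x → 1 ≤ countIn B x a m → 2 ≤ countIn B x a m

    Fits : ℕ → Set
    Fits m = 1 ≤ m × a + m ≤ ℓ B × Closed m

    fits? : ∀ m → Dec (Fits m)
    fits? m = (1 ℕP.≤? m) ×-dec ((a + m ℕP.≤? ℓ B) ×-dec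
              FinP.all? (λ x → support? x →-dec ((1 ℕP.≤? countIn B x a m) →-dec (2 ℕP.≤? countIn B x a m))))

    -- The whole suffix from a is closed: it contains both positions of every supported column.
    suffix-fits : Fits (ℓ B ∸ a)
    suffix-fits = ℕP.m<n⇒0<n∸m a<ℓ , ℕP.≤-reflexive a+[ℓ∸a]≡ℓ , closed
      where
      a+[ℓ∸a]≡ℓ : a + (ℓ B ∸ a) ≡ ℓ B
      a+[ℓ∸a]≡ℓ = ℕP.m+[n∸m]≡n (ℕP.<⇒≤ a<ℓ)
      closed : Closed (ℓ B ∸ a)
      closed x supported@(k , k<L , ck≢0 , _) _ with pair-of k k<L (support-vertex supported)
      ... | I<J , ei , ej , _ = countIn-two B x a (ℓ B ∸ a) (I k) (J k) (starts-after k k<L ck≢0) I<J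
                                  (ℕP.<-≤-trans (end<ℓ k k<L) (ℕP.≤-reflexive (sym a+[ℓ∸a]≡ℓ))) ei ej

    module ShortestClosed (m : ℕ) (fits : Fits m) (shortest : ∀ q → q < m → ¬ Fits q) where

      closed : Closed m
      closed = proj₂ (proj₂ fits)

      prefix-shorter : ∀ p → a ≤ p → p < a + m → p ∸ a < m
      prefix-shorter p a≤p p<a+m = subst (p ∸ a <_) (ℕP.m+n∸m≡n a m) (ℕP.∸-monoˡ-< p<a+m a≤p)

      open-prefix : ∀ m' → 1 ≤ m' → m' < m → Σ (Fin n) λ u → Support u × 1 ≤ countIn B u a m' × ¬ (2 ≤ countIn B u a m')
      open-prefix m' 1≤m' m'<m with FinP.¬∀⟶∃¬ n _ (λ x → support? x →-dec ((1 ℕP.≤? countIn B x a m') →-dec (2 ℕP.≤? countIn B x a m')))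
                                     (λ closed' → shortest m' m'<m (1≤m' , ℕP.≤-trans (ℕP.+-monoʳ-≤ a (ℕP.<⇒≤ m'<m)) (proj₁ (proj₂ fits)) , λ x → closed' x))
      ... | u , not-closed-at-u with support? u | 1 ℕP.≤? countIn B u a m'
      ...   | no unsupported | _ = ⊥-elim (not-closed-at-u (λ supported → ⊥-elim (unsupported supported)))
      ...   | yes _ | no absent = ⊥-elim (not-closed-at-u (λ _ occurs → ⊥-elim (absent occurs)))
      ...   | yes supported | yes occurs = u , supported , occurs , λ twice → not-closed-at-u (λ _ _ → twice)

      encloses : ∀ u k (k<L : k < L) → c k ≢ 0ℚ → vertex k k<L ≡ u → ∀ p → a ≤ p → p < a + m → nth B p ≢ just u →
        1 ≤ countIn B u a (p ∸ a) → ¬ (2 ≤ countIn B u a (p ∸ a)) → I k < p × p < J k × J k < a + m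
      encloses u k k<L ck≢0 is-u p a≤p p<a+m p-not-u occurs not-twice = I<p , p<J , J<a+m
        where
        a+[p∸a]≡p : a + (p ∸ a) ≡ p
        a+[p∸a]≡p = ℕP.m+[n∸m]≡n a≤p
        pair-k : PairOf B u (column k)
        pair-k = pair-of k k<L is-u
        initial : Initial B (column k)
        initial = supported-initial k k<L ck≢0
        a≤I : a ≤ I k
        a≤I = starts-after k k<L ck≢0
        I<p : I k < p
        I<p with occurrenceIn B u a (p ∸ a) occurs
        ... | q , _ , q<p , eq = ℕP.≤-<-trans (initial-first B u (I k) (J k) q (proj₁ (proj₂ pair-k)) initial eq)
                                             (ℕP.<-≤-trans q<p (ℕP.≤-reflexive a+[p∸a]≡p))
        p<J : p < J k
        p<J with ℕP.<-cmp p (J k)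
        ... | tri< p<J _ _ = p<J
        ... | tri≈ _ p≡J _ = ⊥-elim (p-not-u (trans (cong (nth B) p≡J) (proj₁ (proj₂ (proj₂ pair-k)))))
        ... | tri> _ _ J<p = ⊥-elim (not-twice (countIn-two B u a (p ∸ a) (I k) (J k) a≤I (proj₁ pair-k)
                                (ℕP.<-≤-trans J<p (ℕP.≤-reflexive (sym a+[p∸a]≡p))) (proj₁ (proj₂ pair-k)) (proj₁ (proj₂ (proj₂ pair-k)))))
        supported : Support u
        supported = k , k<L , ck≢0 , trans (vertex-at k k<L) (cong just is-u)
        J<a+m : J k < a + m
        J<a+m with firstTwoIn B u a m (closed u supported (countIn-pos B u a m (I k) a≤I (ℕP.<-trans I<p p<a+m) (proj₁ (proj₂ pair-k))))
        ... | q₁ , q₂ , _ , q₁<q₂ , q₂<a+m , eq₁ , eq₂ , _ =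
          ℕP.≤-<-trans (pair-next B u (I k) (J k) q₂ pair-k
                          (ℕP.≤-<-trans (initial-first B u (I k) (J k) q₁ (proj₁ (proj₂ pair-k)) initial eq₁) q₁<q₂) eq₂)
                       q₂<a+m

      -- A vertex occurring once in the window is supported: otherwise the supported vertex occurring
      -- once before it (which exists by minimality of m) has a supported column in which it moves once.
      once-supported : ∀ x → countIn B x a m ≡ 1 → Support x
      once-supported x once with occurrenceIn B x a m (ℕP.≤-reflexive (sym once))
      ... | p , a≤p , p<a+m , ep with ℕP.m≤n⇒m<n∨m≡n a≤p
      ...   | inj₂ refl = supported-at-a x ep
      ...   | inj₁ a<p with open-prefix (p ∸ a) (ℕP.m<n⇒0<n∸m a<p) (prefix-shorter p a≤p p<a+m)
      ...     | u , supported@(k , k<L , ck≢0 , _) , occurs , not-twice with u F.≟ x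
      ...       | yes refl = supported
      ...       | no u≢x with encloses u k k<L ck≢0 (support-vertex supported) p a≤p p<a+m
                                     (λ eu → u≢x (just-injective (trans (sym eu) ep))) occurs not-twice
      ...         | I<p , p<J , J<a+m = support-closed k k<L ck≢0 x
                      (once-between B x a m (I k) (J k) p (starts-after k k<L ck≢0) I<p p<J (ℕP.<⇒≤ J<a+m) once ep)

      window-repeats : ∀ x → 1 ≤ countIn B x a m → 2 ≤ countIn B x a m
      window-repeats x occurs with 2 ℕP.≤? countIn B x a m
      ... | yes twice = twice
      ... | no not-twice = ⊥-elim (not-twice (closed x (once-supported x once) occurs))
        where
        once : countIn B x a m ≡ 1
        once = ℕP.≤-antisym (ℕP.≤-pred (ℕP.≰⇒> not-twice)) occurs

      -- The window is a proper block: the whole of B contains the singleton w₀.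
      window-proper : m < ℓ B
      window-proper with m ℕP.<? ℓ B
      ... | yes m<ℓ = m<ℓ
      ... | no m≮ℓ = ⊥-elim (singleton-once B w₀ w₀-single (subst (2 ≤_) window-is-B
                        (window-repeats w₀ (ℕP.≤-reflexive (sym (trans window-is-B w₀-single))))))
        where
        a≡0 : a ≡ 0
        a≡0 = ℕP.n≤0⇒n≡0 (ℕP.+-cancelʳ-≤ m a 0 (ℕP.≤-trans (proj₁ (proj₂ fits)) (ℕP.≮⇒≥ m≮ℓ)))
        m≡ℓ : m ≡ ℓ B
        m≡ℓ = ℕP.≤-antisym (ℕP.≤-trans (ℕP.m≤n+m m a) (proj₁ (proj₂ fits))) (ℕP.≮⇒≥ m≮ℓ)
        window-is-B : countIn B w₀ a m ≡ count w₀ B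
        window-is-B = trans (cong₂ (countIn B w₀) a≡0 m≡ℓ) (sym (count-total B w₀))

      -- A proper block without singletons cannot be short.
      impossible : ⊥
      impossible = ℕP.<-irrefl refl (ℕP.<-≤-trans (short a m (proj₁ fits) (proj₁ (proj₂ fits)) window-proper)
        (no-singletons-long (block B a m) (λ x occurs → subst (2 ≤_) (sym (countIn-block B x a m))
          (window-repeats x (subst (1 ≤_) (countIn-block B x a m) occurs)))))

  unsupported-column : ∀ k → k < L → c k ≢ 0ℚ → ⊥
  unsupported-column k k<L ck≢0 with least SupportedAt supportedAt? (I k) (vertex k k<L , vertex-at k k<L , (k , k<L , ck≢0 , vertex-at k k<L))
  ... | a , a-supported , a-first with least Fits fits? (ℓ B ∸ a) suffix-fits
    where open FromFirstSupported a a-supported a-first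
  ...   | m , fits , shortest = ShortestClosed.impossible m fits shortest
    where open FromFirstSupported a a-supported a-first

  coefficients-zero : length cs ≡ L → All (_≡ 0ℚ) cs
  coefficients-zero same-length = all-at cs 0ℚ λ k k<len → zero-at k (subst (k <_) same-length k<len)
    where
    zero-at : ∀ k → k < L → c k ≡ 0ℚ
    zero-at k k<L with c k ℚP.≟ 0ℚ
    ... | yes ck≡0 = ck≡0
    ... | no ck≢0 = ⊥-elim (unsupported-column k k<L ck≢0)

admissible-independent : ∀ {n} (B : Seq n) τ ps → Admissible B ps → (w₀ : Fin n) → count w₀ B ≡ 1 → Short B →
  Independent B τ ps
admissible-independent B τ ps admissible w₀ single short cs same-length relation =
  Independence.coefficients-zero B τ ps admissible w₀ single short cs relation same-length

-- A left-to-right scan of a sequence recording the pairs of v inside which some vertex outside p moves.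
-- Comparing it with the computation of the maximal p-runs bounds the number of runs containing v.
module CrossingScan {n} (p : Fin n → Bool) (v : Fin n) where

  -- unseen: v has not moved yet; clean i: v last moved at i, since then only vertices in p;
  -- crossed i k w: v last moved at i, and w ∉ p moved at k since.
  data Phase : Set where
    unseen : Phase
    clean : ℕ → Phase
    crossed : ℕ → ℕ → Fin n → Phase

  IsClean : Phase → Set
  IsClean (clean _) = ⊤
  IsClean _ = ⊥

  -- Runs containing v that are not yet paid for by a crossing pair.
  budget : Phase → ℕ
  budget (crossed _ _ _) = 0
  budget _ = 1

  completed : Phase → ℕ → List (ℕ × ℕ)
  completed (crossed i _ _) t = (i , t) ∷ []
  completed _ t = []

  outsideMove : Phase → ℕ → Fin n → Phase
  outsideMove unseen t x = unseen
  outsideMove (clean i) t x = crossed i t x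
  outsideMove (crossed i k w) t x = crossed i k w

  crossings : Phase → ℕ → Seq n → List (ℕ × ℕ)
  crossings ph t [] = []
  crossings ph t (x ∷ xs) =
    if ⌊ v F.≟ x ⌋ then completed ph t ++ crossings (clean t) (suc t) xs
    else (if p x then crossings ph (suc t) xs else crossings (outsideMove ph t x) (suc t) xs)

  runsWith : List (Seq n) → ℕ
  runsWith Ts = length (filter (λ T → v ∈ᵇ T Bool.≟ true) Ts)

  runsWith-++ : ∀ xs ys → runsWith (xs ++ ys) ≡ runsWith xs + runsWith ys
  runsWith-++ xs ys = trans (cong length (ListP.filter-++ (λ T → v ∈ᵇ T Bool.≟ true) xs ys))
                            (ListP.length-++ (filter (λ T → v ∈ᵇ T Bool.≟ true) xs))

  runsWith-close-absent : ∀ acc → v ∈ᵇ acc ≡ false → runsWith (closeRun acc) ≡ 0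
  runsWith-close-absent [] _ = refl
  runsWith-close-absent (x ∷ acc) v∉acc rewrite v∉acc = refl

  runsWith-close≤1 : ∀ acc → runsWith (closeRun acc) ≤ 1
  runsWith-close≤1 [] = z≤n
  runsWith-close≤1 (x ∷ acc) with v ∈ᵇ (x ∷ acc) Bool.≟ true
  ... | yes _ = s≤s z≤n
  ... | no _ = z≤n

  ∈ᵇ-∷ʳ-other : ∀ (acc : Seq n) x → v ≢ x → v ∈ᵇ (acc ∷ʳ x) ≡ v ∈ᵇ acc
  ∈ᵇ-∷ʳ-other [] x v≢x with v F.≟ x
  ... | yes v≡x = ⊥-elim (v≢x v≡x)
  ... | no _ = refl
  ∈ᵇ-∷ʳ-other (y ∷ acc) x v≢x = cong (⌊ v F.≟ y ⌋ ∨_) (∈ᵇ-∷ʳ-other acc x v≢x)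

  -- Closing the current run at a move of x ∉ p costs at most what the phase loses from its budget,
  -- since the run contains v only in a clean phase.
  close-run : ∀ acc ph t x rest → (v ∈ᵇ acc ≡ true → IsClean ph) →
    runsWith (closeRun acc) + (budget (outsideMove ph t x) + rest) ≤ budget ph + rest
  close-run acc unseen t x rest clean-if-in with v ∈ᵇ acc in v∈?acc
  ... | false rewrite runsWith-close-absent acc v∈?acc = ℕP.≤-refl
  ... | true = ⊥-elim (clean-if-in refl)
  close-run acc (clean i) t x rest _ = ℕP.+-monoˡ-≤ _ (runsWith-close≤1 acc)
  close-run acc (crossed i k w) t x rest clean-if-in with v ∈ᵇ acc in v∈?acc
  ... | false rewrite runsWith-close-absent acc v∈?acc = ℕP.≤-refl
  ... | true = ⊥-elim (clean-if-in refl)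

  -- While v is in the current run, the scan is in a clean phase; then every run containing v,
  -- except the one paid for by the budget, is followed by a move outside p and a completed crossing pair.
  runs≤crossings : p v ≡ true → ∀ acc ph t xs → (v ∈ᵇ acc ≡ true → IsClean ph) →
    runsWith (runsAcc p acc xs) ≤ budget ph + length (crossings ph t xs)
  runs≤crossings pv acc ph t [] clean-if-in with v ∈ᵇ acc in v∈?acc
  ... | false = ℕP.≤-trans (ℕP.≤-reflexive (runsWith-close-absent acc v∈?acc)) z≤n
  ... | true with ph | clean-if-in refl
  ...   | clean _ | _ = ℕP.≤-trans (runsWith-close≤1 acc) (s≤s z≤n)
  runs≤crossings pv acc ph t (x ∷ xs) clean-if-in with v F.≟ x
  runs≤crossings pv acc ph t (x ∷ xs) clean-if-in | yes refl rewrite pv = begin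
    runsWith (runsAcc p (acc ∷ʳ v) xs)                                  ≤⟨ runs≤crossings pv (acc ∷ʳ v) (clean t) (suc t) xs (λ _ → tt) ⟩
    1 + length (crossings (clean t) (suc t) xs)                         ≡⟨ sym (pay ph) ⟩
    budget ph + (length (completed ph t) + length (crossings (clean t) (suc t) xs)) ≡⟨ cong (budget ph +_) (sym (ListP.length-++ (completed ph t))) ⟩
    budget ph + length (completed ph t ++ crossings (clean t) (suc t) xs) ∎
    where
    open ℕP.≤-Reasoning
    pay : ∀ ph → budget ph + (length (completed ph t) + length (crossings (clean t) (suc t) xs)) ≡ 1 + length (crossings (clean t) (suc t) xs)
    pay unseen = refl
    pay (clean _) = refl
    pay (crossed _ _ _) = refl
  runs≤crossings pv acc ph t (x ∷ xs) clean-if-in | no v≢x with p x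
  ... | true = runs≤crossings pv (acc ∷ʳ x) ph (suc t) xs (λ v∈ → clean-if-in (trans (sym (∈ᵇ-∷ʳ-other acc x v≢x)) v∈))
  ... | false = begin
    runsWith (closeRun acc ++ runsAcc p [] xs)                                ≡⟨ runsWith-++ (closeRun acc) (runsAcc p [] xs) ⟩
    runsWith (closeRun acc) + runsWith (runsAcc p [] xs)                      ≤⟨ ℕP.+-monoʳ-≤ (runsWith (closeRun acc)) (runs≤crossings pv [] ph′ (suc t) xs (λ ())) ⟩
    runsWith (closeRun acc) + (budget ph′ + length (crossings ph′ (suc t) xs)) ≤⟨ close-run acc ph t x _ clean-if-in ⟩
    budget ph + length (crossings ph′ (suc t) xs)                             ∎
    where
    open ℕP.≤-Reasoning
    ph′ : Phase
    ph′ = outsideMove ph t x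

∈⇒∈ᵇ : ∀ {n} (x : Fin n) xs → x ∈ xs → x ∈ᵇ xs ≡ true
∈⇒∈ᵇ x (y ∷ xs) (here refl) with x F.≟ x
... | yes _ = refl
... | no x≢x = ⊥-elim (x≢x refl)
∈⇒∈ᵇ x (y ∷ xs) (there x∈xs) rewrite ∈⇒∈ᵇ x xs x∈xs = BoolP.∨-zeroʳ _

repeating⇒∈S₂ : ∀ {n} (B : Seq n) w → 2 ≤ count w B → w ∈ᵇ S₂ B ≡ true
repeating⇒∈S₂ {n} B w twice = ∈⇒∈ᵇ w (S₂ B) (∈P.∈-filter⁺ (λ v → 2 ≤? count v B) (∈P.∈-allFin w) twice)

nth⇒< : ∀ {n} (B : Seq n) k x → nth B k ≡ just x → k < length B
nth⇒< (y ∷ B) zero x _ = s≤s z≤n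
nth⇒< (y ∷ B) (suc k) x e = s≤s (nth⇒< B k x e)

∉S₂⇒singleton : ∀ {n} (B : Seq n) w k → w ∈ᵇ S₂ B ≡ false → nth B k ≡ just w → count w B ≡ 1
∉S₂⇒singleton B w k w∉S₂ ew = ℕP.≤-antisym
  (ℕP.≤-pred (ℕP.≰⇒> (λ twice → subst (λ b → b ≡ false → ⊥) (sym (repeating⇒∈S₂ B w twice)) (λ ()) w∉S₂)))
  (ℕP.≤-trans (countIn-pos B w 0 (length B) k z≤n (nth⇒< B k w ew) ew) (ℕP.≤-reflexive (sym (count-total B w))))

drop-∷ : ∀ {n} (B : Seq n) t x xs → drop t B ≡ x ∷ xs → nth B t ≡ just x × drop (suc t) B ≡ xs
drop-∷ (y ∷ B) zero x xs refl = refl , refl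
drop-∷ (y ∷ B) (suc t) x xs e = drop-∷ B t x xs e

module CrossingPairs {n} (B : Seq n) (v : Fin n) where

  repeating : Fin n → Bool
  repeating x = x ∈ᵇ S₂ B

  open CrossingScan repeating v public

  LastMove : ℕ → ℕ → Set
  LastMove i t = i < t × nth B i ≡ just v × NoneBetween B v i t

  Sound : Phase → ℕ → Set
  Sound unseen t = ∀ q → q < t → nth B q ≢ just v
  Sound (clean i) t = LastMove i t
  Sound (crossed i k w) t = LastMove i t × i < k × k < t × nth B k ≡ just w × repeating w ≡ false

  Found : ℕ → ℕ × ℕ → Set
  Found t q = IsPair B q × Crossing B q × nth B (proj₁ q) ≡ just v × t ≤ proj₂ q

  EndsBefore : ℕ × ℕ → ℕ × ℕ → Set
  EndsBefore q q′ = proj₂ q < proj₂ q′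

  none-extend : ∀ i t x → nth B t ≡ just x → v ≢ x → NoneBetween B v i t → NoneBetween B v i (suc t)
  none-extend i t x et v≢x none q i<q q<1+t with ℕP.m≤n⇒m<n∨m≡n (ℕP.≤-pred q<1+t)
  ... | inj₁ q<t = none q i<q q<t
  ... | inj₂ refl = λ eq → v≢x (just-injective (trans (sym eq) et))

  absent-extend : ∀ t x → nth B t ≡ just x → v ≢ x → (∀ q → q < t → nth B q ≢ just v) → ∀ q → q < suc t → nth B q ≢ just v
  absent-extend t x et v≢x absent q q<1+t with ℕP.m≤n⇒m<n∨m≡n (ℕP.≤-pred q<1+t)
  ... | inj₁ q<t = absent q q<t
  ... | inj₂ refl = λ eq → v≢x (just-injective (trans (sym eq) et))

  last-extend : ∀ i t x → nth B t ≡ just x → v ≢ x → LastMove i t → LastMove i (suc t)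
  last-extend i t x et v≢x (i<t , ei , none) = ℕP.<-trans i<t (ℕP.n<1+n t) , ei , none-extend i t x et v≢x none

  sound-repeating : ∀ ph t x → nth B t ≡ just x → v ≢ x → Sound ph t → Sound ph (suc t)
  sound-repeating unseen t x et v≢x absent = absent-extend t x et v≢x absent
  sound-repeating (clean i) t x et v≢x last = last-extend i t x et v≢x last
  sound-repeating (crossed i k w) t x et v≢x (last , i<k , k<t , ek , w∉) =
    last-extend i t x et v≢x last , i<k , ℕP.<-trans k<t (ℕP.n<1+n t) , ek , w∉

  sound-outside : ∀ ph t x → nth B t ≡ just x → v ≢ x → repeating x ≡ false → Sound ph t → Sound (outsideMove ph t x) (suc t)
  sound-outside unseen t x et v≢x x∉ absent = absent-extend t x et v≢x absent
  sound-outside (clean i) t x et v≢x x∉ last@(i<t , _) = last-extend i t x et v≢x last , i<t , ℕP.n<1+n t , et , x∉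
  sound-outside (crossed i k w) t x et v≢x x∉ sound = sound-repeating (crossed i k w) t x et v≢x sound

  completed-found : ∀ ph t → nth B t ≡ just v → Sound ph t → All (Found t) (completed ph t)
  completed-found unseen t et _ = []
  completed-found (clean i) t et _ = []
  completed-found (crossed i k w) t et ((i<t , ei , none) , i<k , k<t , ek , w∉) =
    ((i<t , nth⇒< B t v et , v , ei , et , none) , (k , i<k , k<t , w , ek , ∉S₂⇒singleton B w k w∉ ek) , ei , ℕP.≤-refl) ∷ []

  found-weaken : ∀ {t t′} → t ≤ t′ → ∀ {qs} → All (Found t′) qs → All (Found t) qs
  found-weaken t≤t′ [] = []
  found-weaken t≤t′ ((pair , crossing , ei , t′≤j) ∷ found) = (pair , crossing , ei , ℕP.≤-trans t≤t′ t′≤j) ∷ found-weaken t≤t′ found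

  crossings-sound : ∀ ph t xs → Sound ph t → drop t B ≡ xs →
    All (Found t) (crossings ph t xs) × AllPairs EndsBefore (crossings ph t xs)
  crossings-sound ph t [] _ _ = [] , []
  crossings-sound ph t (x ∷ xs) sound drop≡ with drop-∷ B t x xs drop≡
  ... | et , drop≡′ with v F.≟ x
  ...   | yes refl = AllP.++⁺ (completed-found ph t et sound) (found-weaken (ℕP.n≤1+n t) (proj₁ rest)) ,
                     AllPairsP.++⁺ (completed-sorted ph) (proj₂ rest) (completed-first ph)
    where
    rest : All (Found (suc t)) (crossings (clean t) (suc t) xs) × AllPairs EndsBefore (crossings (clean t) (suc t) xs)
    rest = crossings-sound (clean t) (suc t) xs
             (ℕP.n<1+n t , et , λ q t<q q<1+t → ⊥-elim (ℕP.<-irrefl refl (ℕP.<-≤-trans t<q (ℕP.≤-pred q<1+t)))) drop≡′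
    completed-sorted : ∀ ph → AllPairs EndsBefore (completed ph t)
    completed-sorted unseen = []
    completed-sorted (clean _) = []
    completed-sorted (crossed _ _ _) = [] ∷ []
    ends-after : ∀ {qs} → All (Found (suc t)) qs → All (λ q → t < proj₂ q) qs
    ends-after [] = []
    ends-after ((_ , _ , _ , t<j) ∷ found) = t<j ∷ ends-after found
    completed-first : ∀ ph → All (λ q → All (EndsBefore q) (crossings (clean t) (suc t) xs)) (completed ph t)
    completed-first unseen = []
    completed-first (clean _) = []
    completed-first (crossed _ _ _) = ends-after (proj₁ rest) ∷ []
  ...   | no v≢x with repeating x in x∈?
  ...     | true = let (found , sorted) = crossings-sound ph (suc t) xs (sound-repeating ph t x et v≢x sound) drop≡′
                   in found-weaken (ℕP.n≤1+n t) found , sorted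
  ...     | false = let (found , sorted) = crossings-sound (outsideMove ph t x) (suc t) xs (sound-outside ph t x et v≢x x∈? sound) drop≡′
                    in found-weaken (ℕP.n≤1+n t) found , sorted

module Columns {n} (B : Seq n) where

  initialPair : ∀ v → 2 ≤ count v B → ℕ × ℕ
  initialPair v twice with firstTwoIn B v 0 (length B) (subst (2 ≤_) (count-total B v) twice)
  ... | p , q , _ = p , q

  initialPair-ok : ∀ v twice → IsPair B (initialPair v twice) × Initial B (initialPair v twice) × nth B (proj₁ (initialPair v twice)) ≡ just v
  initialPair-ok v twice with firstTwoIn B v 0 (length B) (subst (2 ≤_) (count-total B v) twice)
  ... | p , q , _ , p<q , q<ℓ , ep , eq , before , between = (p<q , q<ℓ , v , ep , eq , between) , initial , ep
    where
    initial : Initial B (p , q)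
    initial v′ ep′ r r<p er = before r z≤n r<p (trans er (cong just (just-injective (trans (sym ep′) ep))))

  crossingPairs : Fin n → List (ℕ × ℕ)
  crossingPairs v = CrossingPairs.crossings B v (CrossingPairs.unseen {B = B} {v = v}) 0 B

  orInitial : List (ℕ × ℕ) → ℕ × ℕ → List (ℕ × ℕ)
  orInitial [] q = q ∷ []
  orInitial (q′ ∷ qs) _ = q′ ∷ qs

  columnsOf : ∀ v → 2 ≤ count v B → List (ℕ × ℕ)
  columnsOf v twice = orInitial (crossingPairs v) (initialPair v twice)

  Column : ℕ × ℕ → Set
  Column q = IsPair B q × (Crossing B q ⊎ Initial B q)

  StartsAt : Fin n → ℕ × ℕ → Set
  StartsAt v q = nth B (proj₁ q) ≡ just v

  columnsOf-ok : ∀ v twice → All (λ q → Column q × StartsAt v q) (columnsOf v twice) × AllPairs _≢_ (columnsOf v twice)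
  columnsOf-ok v twice = choose (crossingPairs v) (CrossingPairs.crossings-sound B v (CrossingPairs.unseen {B = B} {v = v}) 0 B (λ _ ()) refl)
    where
    open CrossingPairs B v using (Found; EndsBefore)
    choose : ∀ qs → All (Found 0) qs × AllPairs EndsBefore qs →
      All (λ q → Column q × StartsAt v q) (orInitial qs (initialPair v twice)) × AllPairs _≢_ (orInitial qs (initialPair v twice))
    choose [] _ with initialPair-ok v twice
    ... | pair , initial , starts = (((pair , inj₂ initial) , starts) ∷ []) , ([] ∷ [])
    choose (q ∷ qs) (found , sorted) =
      All.map (λ (pair , crossing , starts , _) → (pair , inj₁ crossing) , starts) found ,
      AllPairs.map (λ j<j′ q≡q′ → ℕP.<-irrefl (cong proj₂ q≡q′) j<j′) sorted

  blocks≤1+crossings : ∀ v → 2 ≤ count v B → bB B v ≤ 1 + length (crossingPairs v)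
  blocks≤1+crossings v twice = CrossingPairs.runs≤crossings B v (repeating⇒∈S₂ B v twice) [] (CrossingPairs.unseen {B = B} {v = v}) 0 B (λ ())

  columnsOf-length : ∀ v twice → 1 ≤ length (columnsOf v twice) × bB B v ∸ 1 ≤ length (columnsOf v twice)
  columnsOf-length v twice = bound (crossingPairs v) (blocks≤1+crossings v twice)
    where
    bound : ∀ qs → bB B v ≤ 1 + length qs → 1 ≤ length (orInitial qs (initialPair v twice)) × bB B v ∸ 1 ≤ length (orInitial qs (initialPair v twice))
    bound [] b≤1 = s≤s z≤n , ℕP.≤-trans (ℕP.∸-monoˡ-≤ 1 b≤1) z≤n
    bound (q ∷ qs) b≤ = s≤s z≤n , ℕP.∸-monoˡ-≤ 1 b≤

  allColumns : ∀ vs → All (λ v → 2 ≤ count v B) vs → List (ℕ × ℕ)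
  allColumns [] [] = []
  allColumns (v ∷ vs) (twice ∷ twices) = columnsOf v twice ++ allColumns vs twices

  allColumns-admissible : ∀ vs twices → AllPairs _≢_ vs →
    All (λ q → Column q × Σ (Fin n) λ x → x ∈ vs × StartsAt x q) (allColumns vs twices) × AllPairs _≢_ (allColumns vs twices)
  allColumns-admissible [] [] [] = [] , []
  allColumns-admissible (v ∷ vs) (twice ∷ twices) (v∉vs ∷ distinct) =
    AllP.++⁺ (All.map (λ (column , starts) → column , v , here refl , starts) (proj₁ here-ok))
             (All.map (λ (column , x , x∈vs , starts) → column , x , there x∈vs , starts) (proj₁ rest-ok)) ,
    AllPairsP.++⁺ (proj₂ here-ok) (proj₂ rest-ok) different-vertices
    where
    here-ok : All (λ q → Column q × StartsAt v q) (columnsOf v twice) × AllPairs _≢_ (columnsOf v twice)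
    here-ok = columnsOf-ok v twice
    rest-ok : All (λ q → Column q × Σ (Fin n) λ x → x ∈ vs × StartsAt x q) (allColumns vs twices) × AllPairs _≢_ (allColumns vs twices)
    rest-ok = allColumns-admissible vs twices distinct
    different-vertices : All (λ q → All (q ≢_) (allColumns vs twices)) (columnsOf v twice)
    different-vertices = All.map (λ (_ , starts-v) → All.map (λ (_ , x , x∈vs , starts-x) q≡q′ →
        All.lookup v∉vs x∈vs (just-injective (trans (sym starts-v) (trans (cong (λ q → nth B (proj₁ q)) q≡q′) starts-x))))
      (proj₁ rest-ok)) (proj₁ here-ok)

  -- Each repeating vertex contributes max(1 , b(v) − 1) columns, which adds up to s₂ − r + Σ (b(v) − 1).
  allColumns-length : ∀ vs twices →
    length vs ∸ length (filter (λ v → 2 ≤? bB B v) vs) + sum (map (λ v → bB B v ∸ 1) vs) ≤ length (allColumns vs twices)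
  allColumns-length [] [] = z≤n
  allColumns-length (v ∷ vs) (twice ∷ twices) with 2 ≤? bB B v
  ... | yes b≥2 rewrite ListP.filter-accept (λ v → 2 ≤? bB B v) {v} {vs} b≥2 | ListP.length-++ (columnsOf v twice) {allColumns vs twices} =
    ℕP.≤-trans (ℕP.≤-reflexive (swap (length vs ∸ length (filter (λ v → 2 ≤? bB B v) vs)) (bB B v ∸ 1) (sum (map (λ v → bB B v ∸ 1) vs))))
               (ℕP.+-mono-≤ (proj₂ (columnsOf-length v twice)) (allColumns-length vs twices))
    where
    swap : ∀ x b y → x + (b + y) ≡ b + (x + y)
    swap x b y = trans (sym (ℕP.+-assoc x b y)) (trans (cong (_+ y) (ℕP.+-comm x b)) (ℕP.+-assoc b x y))
  ... | no b≱2 rewrite ListP.filter-reject (λ v → 2 ≤? bB B v) {v} {vs} b≱2 | ListP.length-++ (columnsOf v twice) {allColumns vs twices}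
                     | ℕP.m≤n⇒m∸n≡0 {bB B v} {1} (ℕP.≤-pred (ℕP.≰⇒> b≱2)) | ℕP.+-∸-assoc 1 (ListP.length-filter (λ v → 2 ≤? bB B v) vs) =
    ℕP.+-mono-≤ (proj₁ (columnsOf-length v twice)) (allColumns-length vs twices)

singleton-from-S₁ : ∀ {n} (B : Seq n) → S₁ B ≢ [] → Σ (Fin n) λ w → count w B ≡ 1
singleton-from-S₁ {n} B S₁≢[] with S₁ B in S₁≡
... | [] = ⊥-elim (S₁≢[] refl)
... | w ∷ _ = w , proj₂ (∈P.∈-filter⁻ (λ v → count v B ℕ.≟ 1) {xs = allFin n} (subst (w ∈_) (sym S₁≡) (here refl)))

S₂-distinct : ∀ {n} (B : Seq n) → AllPairs _≢_ (S₂ B)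
S₂-distinct B = AllPairsP.filter⁺ (λ v → 2 ≤? count v B) (AllPairsP.tabulate⁺ {f = λ x → x} (λ x≢y → x≢y))

lemma3p15 : (n : ℕ) (β : ℚ) → 0ℚ ℚ.< β → β ℚ.≤ 1ℚ →
    (B : Seq n) → Critical β B →
    S₁ B ≢ [] →
    (τ₀ : Config n) →
    RankAtLeast B τ₀ (s₂ B ∸ r B + excess B)
lemma3p15 n β _ β≤1 B critical S₁≢[] τ₀ =
  take T columns , length-T , All.map (λ (column , _) → proj₁ column) chosen ,
  admissible-independent B τ₀ (take T columns) (All.map proj₁ chosen , AllPairsP.take⁺ T distinct)
    (proj₁ singleton) (proj₂ singleton) (critical⇒short β β≤1 B critical)
  where
  open Columns B
  T : ℕ
  T = s₂ B ∸ r B + excess B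
  repeating : All (λ v → 2 ≤ count v B) (S₂ B)
  repeating = AllP.all-filter (λ v → 2 ≤? count v B) (allFin n)
  columns : List (ℕ × ℕ)
  columns = allColumns (S₂ B) repeating
  admissible : All (λ q → Column q × Σ (Fin n) λ x → x ∈ S₂ B × StartsAt x q) columns × AllPairs _≢_ columns
  admissible = allColumns-admissible (S₂ B) repeating (S₂-distinct B)
  distinct : AllPairs _≢_ columns
  distinct = proj₂ admissible
  chosen : All (λ q → Column q × Σ (Fin n) λ x → x ∈ S₂ B × StartsAt x q) (take T columns)
  chosen = AllP.take⁺ T (proj₁ admissible)
  length-T : length (take T columns) ≡ T
  length-T = trans (ListP.length-take T columns) (ℕP.m≤n⇒m⊓n≡m (allColumns-length (S₂ B) repeating))
  singleton : Σ (Fin n) λ w → count w B ≡ 1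
  singleton = singleton-from-S₁ B S₁≢[]
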